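{- Let $\Sigma=(N,T,\Xi)$ be a cowordism signature and suppose $\Xi$ contains an axiom $\sigma/\vdash\Gamma,A\wp B,\Delta$. Let $\Sigma'$ be obtained from $\Sigma$ by replacing this axiom with $\sigma/\vdash\Gamma,A,B,\Delta$. Then $\Sigma'$ is a well-defined cowordism signature, and $\Sigma$ and $\Sigma'$ generate the same cowordism types: for every LL sequent $\Theta$ over $N$, a cowordism $\tau$ satisfies that $\tau/\vdash\Theta$ is derivable in $\Sigma$ iff it is derivable in $\Sigma'$.
   Context: Cowordisms over $T$. A boundary $X$ is $|X|\in\mathbb N$ with a subset $X_l\subseteq\{1,\dots,|X|\}$ (left endpoints), $X_r$ its complement. $X\otimes Y$: cardinality $|X|+|Y|$, left set $X_l\cup\{|X|+i:i\in Y_l\}$; $\mathbf 1$: cardinality $0$; $X^\perp$: cardinality $|X|$, left set $\{|X|+1-i:i\in X_r\}$. A multiword with boundary $X$ is a perfect matching of $\{1,\dots,|X|\}$ by edges $(i,w,j)$, $w\in T^*$, from left to right endpoints, plus a finite multiset of cyclic words. A cowordism $X\to Y$ is a multiword with boundary $Y\otimes X^\perp$; composition glues vertex $i$ of $\sigma:X\to Y$ to vertex $|Z|+|Y|+1-i$ of $\tau:Y\to Z$, concatenating labels along paths and collecting closed cycles as cyclic words; identities are $\epsilon$-labelled edges joining $i$ and $2|X|+1-i$. Linear logic. Formulas over positive literals $N$: $P,P^\perp$ combined by $\otimes,\wp$, with De Morgan negation. Rules: Id $\vdash A^\perp,A$; Cut; Exchange; $(\wp)$ from $\vdash\Gamma,A,B$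 infer $\vdash\Gamma,A\wp B$; $(\otimes)$ from $\vdash\Gamma,A$ and $\vdash B,\Delta$ infer $\vdash\Gamma,A\otimes B,\Delta$. Interpretation: boundaries $[P]$ for $P\in N$; $[A\otimes B]=[A]\otimes[B]$, $[A^\perp]=[A]^\perp$, hence $[A\wp B]=[B]\otimes[A]$; $[A_1,\dots,A_n]=[A_n]\otimes\dots\otimes[A_1]$. Derivations are interpreted as cowordisms $\mathbf 1\to[\Gamma]$: Id as the identity; Ex by permuting vertex blocks; $(\wp)$ leaves the cowordism unchanged; $(\otimes)$ as the union of the two multiwords with blocks arranged as $[\Delta]\otimes[A]\otimes[B]\otimes[\Gamma]$; Cut by gluing the $[A]$ block of one premise to the $[A]^\perp$ block of the other order-reversingly, as in composition. A cowordism typing judgement $\sigma/\vdash\Gamma$ is an LL sequent $\Gamma$ with a cowordism $\sigma:\mathbf 1\to[\Gamma]$. A cowordism signature $(N,T,\Xi)$: finite set $N$ of positive literals each interpreted as a boundary, finite alphabet $T$, set $\Xi$ of cowordism typing judgements (axioms). $\sigma/\vdash\Gamma$ is derivable if there is an LL derivation of $\vdash\Gamma$ using axiom sequents as additional initial sequents (interpreted by their cowordisms) whose interpretation is $\sigma$. -}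

module Defs where

open import Data.Nat using (ℕ; zero; suc; _+_; _∸_; _<_; _<ᵇ_; _≡ᵇ_)
open import Data.Bool using (Bool; true; false; not; if_then_else_; _∧_; _∨_)
open import Data.List using (List; []; _∷_; _++_; map; reverse; length; concatMap; upTo)
open import Data.List.Relation.Unary.All using (All)
open import Data.List.Relation.Binary.Permutation.Propositional using (_↭_)
open import Data.List.Relation.Binary.Pointwise using (Pointwise)
open import Data.Maybe using (Maybe; just; nothing)
open import Data.Fin using (Fin)
open import Data.Product using (Σ; ∃; ∃₂; _×_; _,_; proj₁)
open import Data.Sum using (_⊎_)
open import Relation.Binary.PropositionalEquality using (_≡_)

-- Boundaries.  A boundary X is the list of its |X| vertex polarities:
-- position i (0-based; vertex i+1 of the paper) is true iff it is a
-- left endpoint.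

Boundary : Set
Boundary = List Bool

_⊗ᵇ_ : Boundary → Boundary → Boundary
X ⊗ᵇ Y = X ++ Y

𝟏 : Boundary
𝟏 = []

_ᵇ⊥ : Boundary → Boundary
X ᵇ⊥ = reverse (map not X)

at : List Bool → ℕ → Maybe Bool
at [] _ = nothing
at (b ∷ X) zero = just b
at (b ∷ X) (suc n) = at X n

occ : ℕ → List ℕ → ℕ
occ k [] = 0
occ k (x ∷ xs) = if k ≡ᵇ x then suc (occ k xs) else occ k xs

-- Everything below is relative to a signature's data:
-- alphabet T = Fin t, positive literals N = Fin k, bnd interprets literals.

module Sig (t k : ℕ) (bnd : Fin k → Boundary) where

  Word : Set
  Word = List (Fin t)

  -- an edge (i , w , j) from left endpoint i to right endpoint j (0-based)
  Edge : Set
  Edge = ℕ × Word × ℕ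

  record RawMW : Set where
    constructor mw
    field
      edges  : List Edge
      cycles : List Word
  open RawMW public

  endpoints : List Edge → List ℕ
  endpoints [] = []
  endpoints ((i , _ , j) ∷ es) = i ∷ j ∷ endpoints es

  EdgeOK : Boundary → Edge → Set
  EdgeOK X (i , _ , j) = (at X i ≡ just true) × (at X j ≡ just false)

  record IsMultiword (X : Boundary) (m : RawMW) : Set where
    field
      directed : All (EdgeOK X) (edges m)
      perfect  : ∀ v → v < length X → occ v (endpoints (edges m)) ≡ 1

  Multiword : Boundary → Set
  Multiword X = Σ RawMW (IsMultiword X)

  Cow : Boundary → Boundary → Set
  Cow X Y = Multiword (Y ⊗ᵇ (X ᵇ⊥))

  -- equality of multiwords: edges as a set (list up to permutation),
  -- cycles as a multiset of cyclic words (up to permutation and rotation)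
  Rot : Word → Word → Set
  Rot u v = ∃₂ λ p q → (u ≡ p ++ q) × (v ≡ q ++ p)

  _≈ᶜ_ : List Word → List Word → Set
  cs ≈ᶜ ds = ∃ λ es → Pointwise Rot cs es × (es ↭ ds)

  _≈_ : RawMW → RawMW → Set
  m ≈ m' = (edges m ↭ edges m') × (cycles m ≈ᶜ cycles m')

  relabel : (ℕ → ℕ) → RawMW → RawMW
  relabel f (mw es cs) = mw (map (λ e → relE e) es) cs
    where
      relE : Edge → Edge
      relE (i , w , j) = f i , w , f j

  union : RawMW → RawMW → RawMW
  union (mw e₁ c₁) (mw e₂ c₂) = mw (e₁ ++ e₂) (c₁ ++ c₂)

  hasEnd : ℕ → Edge → Bool
  hasEnd u (i , _ , j) = (u ≡ᵇ i) ∨ (u ≡ᵇ j)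

  consSnd : Edge → Maybe (Edge × List Edge) → Maybe (Edge × List Edge)
  consSnd e nothing = nothing
  consSnd e (just (f , r)) = just (f , e ∷ r)

  pick : ℕ → List Edge → Maybe (Edge × List Edge)
  pick u [] = nothing
  pick u (e ∷ es) = if hasEnd u e then just (e , []) ++ᵐ es else consSnd e (pick u es)
    where
      _++ᵐ_ : Maybe (Edge × List Edge) → List Edge → Maybe (Edge × List Edge)
      nothing ++ᵐ _ = nothing
      just (f , r) ++ᵐ xs = just (f , r ++ xs)

  join : ℕ → ℕ → Edge → List Edge → RawMW → RawMW → RawMW
  join u v (i₁ , w₁ , j₁) rest (mw _ cs) old with pick v rest
  ... | nothing = old
  ... | just ((i₂ , w₂ , j₂) , rest') =
    if (j₁ ≡ᵇ u) ∧ (i₂ ≡ᵇ v) then mw ((i₁ , w₁ ++ w₂ , j₂) ∷ rest') cs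
    else if (i₁ ≡ᵇ u) ∧ (j₂ ≡ᵇ v) then mw ((i₂ , w₂ ++ w₁ , j₁) ∷ rest') cs
    else old

  -- glue vertex u to vertex v: concatenate labels along the path,
  -- or record a closed cycle as a cyclic word
  glue1 : ℕ → ℕ → RawMW → RawMW
  glue1 u v (mw es cs) with pick u es
  ... | nothing = mw es cs
  ... | just ((i₁ , w₁ , j₁) , rest) =
    if ((i₁ ≡ᵇ u) ∧ (j₁ ≡ᵇ v)) ∨ ((i₁ ≡ᵇ v) ∧ (j₁ ≡ᵇ u))
    then mw rest (w₁ ∷ cs)
    else join u v (i₁ , w₁ , j₁) rest (mw es cs) (mw es cs)

  trace : List (ℕ × ℕ) → RawMW → RawMW
  trace [] m = m
  trace ((u , v) ∷ ps) m = trace ps (glue1 u v m)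

  idEdges : ℕ → ℕ → Boundary → List Edge
  idEdges n i [] = []
  idEdges n i (b ∷ X) =
    (if b then (i , [] , (n + n) ∸ suc i) else ((n + n) ∸ suc i , [] , i))
    ∷ idEdges n (suc i) X

  idRaw : Boundary → RawMW
  idRaw X = mw (idEdges (length X) 0 X) []

  -- [Δ][B][A][Γ]  ↦  [Δ][A][B][Γ]   (block sizes d, b, a)
  swapBlocks : ℕ → ℕ → ℕ → ℕ → ℕ
  swapBlocks d b a v =
    if v <ᵇ d then v
    else if v <ᵇ d + b then v + a
    else if v <ᵇ d + b + a then v ∸ b
    else v

  -- premises with boundaries [A][Γ] and [Δ][B], arranged as [Δ][A][B][Γ]
  tensorRaw : ℕ → ℕ → ℕ → RawMW → RawMW → RawMW
  tensorRaw d a b p q =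
    union (relabel (λ v → if v <ᵇ a then v + d else v + d + b) p)
          (relabel (λ v → if v <ᵇ d then v else v + a) q)

  -- arrange as [Δ][A][A^⊥][Γ], glue the two middle blocks
  -- order-reversingly, and drop them
  cutRaw : ℕ → ℕ → RawMW → RawMW → RawMW
  cutRaw d m p q =
    relabel (λ v → if v <ᵇ d then v else v ∸ (m + m))
      (trace (map (λ i → (d + (m ∸ suc i)) , (d + m + i)) (upTo m))
             (tensorRaw d m m p q))

  infixr 6 _⊗_ _⅋_
  data Formula : Set where
    pos neg : Fin k → Formula
    _⊗_ _⅋_ : Formula → Formula → Formula

  _ᗮ : Formula → Formula
  pos p ᗮ = neg p
  neg p ᗮ = pos p
  (A ⊗ B) ᗮ = (A ᗮ) ⅋ (B ᗮ)
  (A ⅋ B) ᗮ = (A ᗮ) ⊗ (B ᗮ)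

  ⟦_⟧ : Formula → Boundary
  ⟦ pos p ⟧ = bnd p
  ⟦ neg p ⟧ = bnd p ᵇ⊥
  ⟦ A ⊗ B ⟧ = ⟦ A ⟧ ⊗ᵇ ⟦ B ⟧
  ⟦ A ⅋ B ⟧ = ⟦ B ⟧ ⊗ᵇ ⟦ A ⟧

  ⟦_⟧ˢ : List Formula → Boundary
  ⟦ [] ⟧ˢ = 𝟏
  ⟦ A ∷ Γ ⟧ˢ = ⟦ Γ ⟧ˢ ⊗ᵇ ⟦ A ⟧

  len : Formula → ℕ
  len A = length ⟦ A ⟧

  lenˢ : List Formula → ℕ
  lenˢ Γ = length ⟦ Γ ⟧ˢ

  record Judgement : Set where
    constructor _/⊢_
    field
      cow : RawMW
      seq : List Formula
      valid : IsMultiword (⟦ seq ⟧ˢ ⊗ᵇ (𝟏 ᵇ⊥)) cow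

  mkJ : (Γ : List Formula) → Cow 𝟏 ⟦ Γ ⟧ˢ → Judgement
  mkJ Γ (m , v) = record { cow = m ; seq = Γ ; valid = v }

  data Der (Ξ : Judgement → Set) : List Formula → Set where
    axiom    : (j : Judgement) → Ξ j → Der Ξ (Judgement.seq j)
    identity : (A : Formula) → Der Ξ ((A ᗮ) ∷ A ∷ [])
    exchange : (Γ : List Formula) (A B : Formula) (Δ : List Formula) →
               Der Ξ (Γ ++ A ∷ B ∷ Δ) → Der Ξ (Γ ++ B ∷ A ∷ Δ)
    par      : (Γ : List Formula) (A B : Formula) →
               Der Ξ (Γ ++ A ∷ B ∷ []) → Der Ξ (Γ ++ (A ⅋ B) ∷ [])
    tensor   : (Γ : List Formula) (A B : Formula) (Δ : List Formula) →
               Der Ξ (Γ ++ A ∷ []) → Der Ξ (B ∷ Δ) → Der Ξ (Γ ++ (A ⊗ B) ∷ Δ)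
    cut      : (Γ : List Formula) (A : Formula) (Δ : List Formula) →
               Der Ξ (Γ ++ A ∷ []) → Der Ξ ((A ᗮ) ∷ Δ) → Der Ξ (Γ ++ Δ)

  interp : {Ξ : Judgement → Set} {Γ : List Formula} → Der Ξ Γ → RawMW
  interp (axiom j _) = Judgement.cow j
  interp (identity A) = idRaw ⟦ A ⟧
  interp (exchange Γ A B Δ p) = relabel (swapBlocks (lenˢ Δ) (len B) (len A)) (interp p)
  interp (par Γ A B p) = interp p
  interp (tensor Γ A B Δ p q) = tensorRaw (lenˢ Δ) (len A) (len B) (interp p) (interp q)
  interp (cut Γ A Δ p q) = cutRaw (lenˢ Δ) (len A) (interp p) (interp q)

  Derivable : (Judgement → Set) → (Θ : List Formula) → Cow 𝟏 ⟦ Θ ⟧ˢ → Set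
  Derivable Ξ Θ τ = Σ (Der Ξ Θ) λ d → interp d ≈ proj₁ τ

  _∪｛_｝ : (Judgement → Set) → Judgement → (Judgement → Set)
  (Ξ ∪｛ j ｝) j' = Ξ j' ⊎ (j' ≡ j)

module Submission where

-- σ/⊢Γ,A⅋B,Δ is derivable from σ/⊢Γ,A,B,Δ by moving Δ out of the way with exchanges,
-- applying (⅋) and moving Δ back: the two exchange relabellings are mutually inverse, so the
-- cowordism is literally unchanged.  Conversely σ/⊢Γ,A,B,Δ is obtained by cutting
-- σ/⊢Γ,A⅋B,Δ against the η-expanded identity ⊢(A⅋B)^⊥,A,B, whose interpretation is the
-- identity on [A⅋B] up to the order of its edges; cutting against an identity gives back the
-- original multiword up to the order of its edges.  On well-formed multiwords the
-- interpretation of every rule, cut included, respects reordering of edges and cycles, so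
-- replacing an axiom by such a derivation everywhere preserves interpretations up to a
-- reordering, which is finer than the equality of cowordisms in Derivable.

open import Data.Nat using (ℕ; zero; suc; _+_; _∸_; _≤_; _<_; z≤n; s≤s; s≤s⁻¹; z<s; _≡ᵇ_; _<ᵇ_; _≟_; _<?_)
open import Data.Nat.Properties
open import Data.Nat.Tactic.RingSolver using (solve-∀)
open import Data.Bool using (Bool; true; false; not; if_then_else_; T)
open import Data.Bool.Properties using (not-involutive)
open import Data.Fin using (Fin)
open import Data.List using (List; []; _∷_; _++_; map; length; reverse; upTo; applyUpTo; take)
open import Data.List.Properties using (length-++; length-map; length-reverse; unfold-reverse; ++-assoc; ++-identityʳ; map-++; reverse-++; reverse-map; reverse-involutive; take-all; length-take; map-∘; map-cong; map-id)
open import Data.List.Relation.Unary.All as All using (All; []; _∷_)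
open import Data.List.Relation.Unary.All.Properties using (++⁺)
open import Data.List.Relation.Unary.Any using (here; there)
open import Data.List.Membership.Propositional using (_∈_)
open import Data.List.Membership.Propositional.Properties using (∈-∃++)
open import Data.List.Relation.Binary.Permutation.Propositional using (_↭_; refl; prep; swap; ↭-sym; ↭-reflexive) renaming (trans to ↭-trans)
open import Data.List.Relation.Binary.Permutation.Propositional.Properties using (map⁺; shift; shifts; drop-∷; ∈-resp-↭; All-resp-↭; ∷↭∷ʳ) renaming (++⁺ to ++⁺-↭; ++⁺ʳ to ++⁺ʳ-↭; ++-comm to ++-comm-↭)
open import Data.List.Relation.Binary.Pointwise using (Pointwise; []; _∷_)
open import Data.Maybe using (just; nothing)
open import Data.Maybe.Properties using (just-injective)
import Data.Maybe as Maybe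
open import Data.Product using (Σ; ∃; _×_; _,_; proj₁; proj₂)
open import Data.Sum using (_⊎_; inj₁; inj₂)
open import Data.Empty using (⊥; ⊥-elim)
open import Data.Unit using (tt)
open import Relation.Nullary using (yes; no)
open import Relation.Binary.PropositionalEquality
open import Function.Bundles using (_⇔_; mk⇔)
open import Defs

≡ᵇ-refl : ∀ n → (n ≡ᵇ n) ≡ true
≡ᵇ-refl zero = refl
≡ᵇ-refl (suc n) = ≡ᵇ-refl n

≡ᵇ≡true⇒≡ : ∀ m n → (m ≡ᵇ n) ≡ true → m ≡ n
≡ᵇ≡true⇒≡ m n e = ≡ᵇ⇒≡ m n (subst T (sym e) tt)

≢⇒≡ᵇ≡false : ∀ m n → m ≢ n → (m ≡ᵇ n) ≡ false
≢⇒≡ᵇ≡false m n m≢n with m ≡ᵇ n in eq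
... | true = ⊥-elim (m≢n (≡ᵇ≡true⇒≡ m n eq))
... | false = refl

≡ᵇ≡false⇒≢ : ∀ m n → (m ≡ᵇ n) ≡ false → m ≢ n
≡ᵇ≡false⇒≢ m .m eq refl with trans (sym eq) (≡ᵇ-refl m)
... | ()

≡ᵇ-resp-⇔ : ∀ a b c e → (a ≡ b → c ≡ e) → (c ≡ e → a ≡ b) → (a ≡ᵇ b) ≡ (c ≡ᵇ e)
≡ᵇ-resp-⇔ a b c e to from with a ≡ᵇ b in p | c ≡ᵇ e in q
... | true  | true  = refl
... | false | false = refl
... | true  | false = ⊥-elim (≡ᵇ≡false⇒≢ c e q (to (≡ᵇ≡true⇒≡ a b p)))
... | false | true  = ⊥-elim (≡ᵇ≡false⇒≢ a b p (from (≡ᵇ≡true⇒≡ c e q)))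

<⇒<ᵇ≡true : ∀ {m n} → m < n → (m <ᵇ n) ≡ true
<⇒<ᵇ≡true {zero} (s≤s _) = refl
<⇒<ᵇ≡true {suc m} (s≤s p) = <⇒<ᵇ≡true p

≥⇒<ᵇ≡false : ∀ {m n} → n ≤ m → (m <ᵇ n) ≡ false
≥⇒<ᵇ≡false z≤n = refl
≥⇒<ᵇ≡false (s≤s p) = ≥⇒<ᵇ≡false p

m∸n≡suc[m∸suc[n]] : ∀ {m n} → n < m → m ∸ n ≡ suc (m ∸ suc n)
m∸n≡suc[m∸suc[n]] n<m = +-∸-assoc 1 n<m

m∸suc[n]<m : ∀ {m n} → n < m → m ∸ suc n < m
m∸suc[n]<m n<m = ∸-monoʳ-< z<s n<m

<⊎≥ : ∀ d x → x < d ⊎ ∃ λ r → x ≡ d + r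
<⊎≥ d x with x <? d
... | yes x<d = inj₁ x<d
... | no x≮d = inj₂ (x ∸ d , sym (m+[n∸m]≡n (≮⇒≥ x≮d)))

data Blocks (d b a : ℕ) : ℕ → Set where
  front  : ∀ {x} → x < d → Blocks d b a x
  first  : ∀ {r} → r < b → Blocks d b a (d + r)
  second : ∀ {r} → r < a → Blocks d b a (d + b + r)
  back   : ∀ r → Blocks d b a (d + b + a + r)

blocks : ∀ d b a x → Blocks d b a x
blocks d b a x with <⊎≥ d x
... | inj₁ x<d = front x<d
... | inj₂ (r , refl) with <⊎≥ b r
... | inj₁ r<b = first r<b
... | inj₂ (s , refl) with <⊎≥ a s
... | inj₁ s<a = subst (Blocks d b a) (+-assoc d b s) (second s<a)
... | inj₂ (r′ , refl) = subst (Blocks d b a) (rearrange d b a r′) (back r′)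
  where
    rearrange : ∀ d b a r → d + b + a + r ≡ d + (b + (a + r))
    rearrange = solve-∀

occ-++ : ∀ v xs ys → occ v (xs ++ ys) ≡ occ v xs + occ v ys
occ-++ v [] ys = refl
occ-++ v (x ∷ xs) ys with v ≡ᵇ x
... | true = cong suc (occ-++ v xs ys)
... | false = occ-++ v xs ys

occ-↭ : ∀ v {xs ys} → xs ↭ ys → occ v xs ≡ occ v ys
occ-↭ v refl = refl
occ-↭ v (prep x p) with v ≡ᵇ x
... | true = cong suc (occ-↭ v p)
... | false = occ-↭ v p
occ-↭ v (swap x y p) with v ≡ᵇ x | v ≡ᵇ y
... | true  | true  = cong (λ n → suc (suc n)) (occ-↭ v p)
... | true  | false = cong suc (occ-↭ v p)
... | false | true  = cong suc (occ-↭ v p)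
... | false | false = occ-↭ v p
occ-↭ v (↭-trans p q) = trans (occ-↭ v p) (occ-↭ v q)

occ-here : ∀ x xs → occ x (x ∷ xs) ≡ suc (occ x xs)
occ-here x xs rewrite ≡ᵇ-refl x = refl

occ-there : ∀ {v} x xs → v ≢ x → occ v (x ∷ xs) ≡ occ v xs
occ-there {v} x xs v≢x rewrite ≢⇒≡ᵇ≡false v x v≢x = refl

occ-pair-first : ∀ u v xs → u ≢ v → occ u (u ∷ v ∷ xs) ≡ suc (occ u xs)
occ-pair-first u v xs u≢v = trans (occ-here u (v ∷ xs)) (cong suc (occ-there v xs u≢v))

occ-pair-second : ∀ u v xs → v ≢ u → occ v (u ∷ v ∷ xs) ≡ suc (occ v xs)
occ-pair-second u v xs v≢u = trans (occ-there u (v ∷ xs) v≢u) (occ-here v xs)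

occ-pair-other : ∀ {w} u v xs → w ≢ u → w ≢ v → occ w (u ∷ v ∷ xs) ≡ occ w xs
occ-pair-other u v xs w≢u w≢v = trans (occ-there u (v ∷ xs) w≢u) (occ-there v xs w≢v)

occ≡0⇒∉ : ∀ {x xs} → occ x xs ≡ 0 → x ∈ xs → ⊥
occ≡0⇒∉ {x} {.x ∷ xs} e (here refl) with trans (sym (occ-here x xs)) e
... | ()
occ≡0⇒∉ {x} {y ∷ xs} e (there p) with x ≡ᵇ y
occ≡0⇒∉ () (there p) | true
... | false = occ≡0⇒∉ e p

occ-map : ∀ (f : ℕ → ℕ) v w xs → (∀ x → x ∈ xs → (f x ≡ v → x ≡ w) × (x ≡ w → f x ≡ v)) →
  occ v (map f xs) ≡ occ w xs
occ-map f v w [] h = refl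
occ-map f v w (x ∷ xs) h
  rewrite ≡ᵇ-resp-⇔ v (f x) w x (λ e → sym (proj₁ (h x (here refl)) (sym e)))
                                  (λ e → sym (proj₂ (h x (here refl)) (sym e)))
  with w ≡ᵇ x
... | true = cong suc (occ-map f v w xs (λ y p → h y (there p)))
... | false = occ-map f v w xs (λ y p → h y (there p))

occ-map-injective : ∀ {f : ℕ → ℕ} → (∀ {x y} → f x ≡ f y → x ≡ y) →
  ∀ {v w} xs → f w ≡ v → occ v (map f xs) ≡ occ w xs
occ-map-injective {f} f-inj xs refl = occ-map f _ _ xs (λ x _ → f-inj , cong f)

occ-map-∉ : ∀ (f : ℕ → ℕ) v xs → (∀ x → x ∈ xs → f x ≢ v) → occ v (map f xs) ≡ 0
occ-map-∉ f v [] h = refl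
occ-map-∉ f v (x ∷ xs) h
  rewrite ≢⇒≡ᵇ≡false v (f x) (λ e → h x (here refl) (sym e)) = occ-map-∉ f v xs (λ y p → h y (there p))

↭-Pointwise⇒Pointwise-↭ : ∀ {A : Set} {R : A → A → Set} {xs ys zs} → xs ↭ ys → Pointwise R ys zs →
  ∃ λ ws → Pointwise R xs ws × (ws ↭ zs)
↭-Pointwise⇒Pointwise-↭ refl pw = _ , pw , refl
↭-Pointwise⇒Pointwise-↭ (prep x p) (r ∷ pw) with ↭-Pointwise⇒Pointwise-↭ p pw
... | _ , pw′ , q = _ , r ∷ pw′ , prep _ q
↭-Pointwise⇒Pointwise-↭ (swap x y p) (ry ∷ rx ∷ pw) with ↭-Pointwise⇒Pointwise-↭ p pw
... | _ , pw′ , q = _ , rx ∷ ry ∷ pw′ , swap _ _ q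
↭-Pointwise⇒Pointwise-↭ (↭-trans p q) pw with ↭-Pointwise⇒Pointwise-↭ q pw
... | _ , pw₁ , q₁ with ↭-Pointwise⇒Pointwise-↭ p pw₁
... | _ , pw₂ , q₂ = _ , pw₂ , ↭-trans q₂ q₁

range : ℕ → ℕ → List ℕ
range j zero = []
range j (suc n) = j ∷ range (suc j) n

upTo≡range : ∀ n → upTo n ≡ range 0 n
upTo≡range = shifted 0
  where
    shifted : ∀ j n → applyUpTo (j +_) n ≡ range j n
    shifted j zero = refl
    shifted j (suc n) = cong₂ _∷_ (+-identityʳ j)
      (trans (applyUpTo-cong n (λ i → +-suc j i)) (shifted (suc j) n))
      where
        applyUpTo-cong : ∀ {f g : ℕ → ℕ} n → (∀ i → f i ≡ g i) → applyUpTo f n ≡ applyUpTo g n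
        applyUpTo-cong zero h = refl
        applyUpTo-cong (suc n) h = cong₂ _∷_ (h 0) (applyUpTo-cong n (λ i → h (suc i)))

at-++ˡ : ∀ (X Y : List Bool) i → i < length X → at (X ++ Y) i ≡ at X i
at-++ˡ (x ∷ X) Y zero _ = refl
at-++ˡ (x ∷ X) Y (suc i) (s≤s i<n) = at-++ˡ X Y i i<n

at-++ʳ : ∀ (X Y : List Bool) j → at (X ++ Y) (length X + j) ≡ at Y j
at-++ʳ [] Y j = refl
at-++ʳ (x ∷ X) Y j = at-++ʳ X Y j

at⇒< : ∀ (X : List Bool) i {b} → at X i ≡ just b → i < length X
at⇒< (x ∷ X) zero _ = s≤s z≤n
at⇒< (x ∷ X) (suc i) e = s≤s (at⇒< X i e)

<⇒at : ∀ (X : List Bool) i → i < length X → ∃ λ b → at X i ≡ just b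
<⇒at (x ∷ X) zero _ = x , refl
<⇒at (x ∷ X) (suc i) (s≤s i<n) = <⇒at X i i<n

at-map : ∀ (f : Bool → Bool) (X : List Bool) i → at (map f X) i ≡ Maybe.map f (at X i)
at-map f [] i = refl
at-map f (x ∷ X) zero = refl
at-map f (x ∷ X) (suc i) = at-map f X i

at-reverse : ∀ (X : List Bool) k → k < length X → at (reverse X) k ≡ at X (length X ∸ suc k)
at-reverse (x ∷ xs) k k<len rewrite unfold-reverse x xs with m≤n⇒m<n∨m≡n (s≤s⁻¹ k<len)
... | inj₁ k<n = begin
  at (reverse xs ++ x ∷ []) k   ≡⟨ at-++ˡ (reverse xs) _ k (subst (k <_) (sym (length-reverse xs)) k<n) ⟩
  at (reverse xs) k             ≡⟨ at-reverse xs k k<n ⟩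
  at (x ∷ xs) (suc (length xs ∸ suc k)) ≡⟨ cong (at (x ∷ xs)) (sym (m∸n≡suc[m∸suc[n]] k<n)) ⟩
  at (x ∷ xs) (length xs ∸ k)   ∎
  where open ≡-Reasoning
... | inj₂ refl = begin
  at (reverse xs ++ x ∷ []) (length xs)   ≡⟨ cong (at (reverse xs ++ x ∷ [])) (sym (trans (+-identityʳ _) (length-reverse xs))) ⟩
  at (reverse xs ++ x ∷ []) (length (reverse xs) + 0) ≡⟨ at-++ʳ (reverse xs) _ 0 ⟩
  just x                                  ≡⟨ cong (at (x ∷ xs)) (sym (n∸n≡0 (length xs))) ⟩
  at (x ∷ xs) (length xs ∸ length xs)     ∎
  where open ≡-Reasoning

take-suc : ∀ (xs : List Bool) j → j < length xs → ∃ λ b → take (suc j) xs ≡ take j xs ++ b ∷ [] × at xs j ≡ just b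
take-suc (x ∷ xs) zero _ = x , refl , refl
take-suc (x ∷ xs) (suc j) (s≤s j<n) with take-suc xs j j<n
... | b , e , at-b = b , cong (x ∷_) e , at-b

length-ᵇ⊥ : ∀ X → length (X ᵇ⊥) ≡ length X
length-ᵇ⊥ X = trans (length-reverse (map not X)) (length-map not X)

at-ᵇ⊥ : ∀ (X : List Bool) k → k < length X → at (X ᵇ⊥) k ≡ Maybe.map not (at X (length X ∸ suc k))
at-ᵇ⊥ X k k<n = begin
  at (reverse (map not X)) k                         ≡⟨ at-reverse (map not X) k (subst (k <_) (sym (length-map not X)) k<n) ⟩
  at (map not X) (length (map not X) ∸ suc k)        ≡⟨ cong (λ n → at (map not X) (n ∸ suc k)) (length-map not X) ⟩
  at (map not X) (length X ∸ suc k)                  ≡⟨ at-map not X _ ⟩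
  Maybe.map not (at X (length X ∸ suc k))            ∎
  where open ≡-Reasoning

ᵇ⊥-++ : ∀ X Y → (X ++ Y) ᵇ⊥ ≡ (Y ᵇ⊥) ++ (X ᵇ⊥)
ᵇ⊥-++ X Y = trans (cong reverse (map-++ not X Y)) (reverse-++ (map not X) (map not Y))

ᵇ⊥-involutive : ∀ X → (X ᵇ⊥) ᵇ⊥ ≡ X
ᵇ⊥-involutive X = begin
  reverse (map not (reverse (map not X)))   ≡⟨ cong reverse (reverse-map not (map not X)) ⟩
  reverse (reverse (map not (map not X)))   ≡⟨ reverse-involutive _ ⟩
  map not (map not X)                       ≡⟨ not-not X ⟩
  X                                         ∎
  where
    open ≡-Reasoning
    not-not : ∀ X → map not (map not X) ≡ X
    not-not [] = refl
    not-not (x ∷ X) = cong₂ _∷_ (not-involutive x) (not-not X)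

module Cowordisms (t k : ℕ) (bnd : Fin k → Boundary) where

  open Sig t k bnd

  -- Degrees of vertices and a single gluing step

  edgeEnds : Edge → List ℕ
  edgeEnds (i , _ , j) = i ∷ j ∷ []

  endpoints-++ : ∀ es fs → endpoints (es ++ fs) ≡ endpoints es ++ endpoints fs
  endpoints-++ [] fs = refl
  endpoints-++ ((i , _ , j) ∷ es) fs = cong (λ ns → i ∷ j ∷ ns) (endpoints-++ es fs)

  endpoints-↭ : ∀ {es fs} → es ↭ fs → endpoints es ↭ endpoints fs
  endpoints-↭ refl = refl
  endpoints-↭ (prep (i , _ , j) p) = prep i (prep j (endpoints-↭ p))
  endpoints-↭ (swap (i , _ , j) (i′ , _ , j′) p) =
    ↭-trans (shifts (i ∷ j ∷ []) (i′ ∷ j′ ∷ [])) (prep i′ (prep j′ (prep i (prep j (endpoints-↭ p)))))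
  endpoints-↭ (↭-trans p q) = ↭-trans (endpoints-↭ p) (endpoints-↭ q)

  degree : ℕ → List Edge → ℕ
  degree v es = occ v (endpoints es)

  degree-∷ : ∀ v e es → degree v (e ∷ es) ≡ occ v (edgeEnds e) + degree v es
  degree-∷ v (i , _ , j) es = occ-++ v (i ∷ j ∷ []) (endpoints es)

  degree-++ : ∀ v es fs → degree v (es ++ fs) ≡ degree v es + degree v fs
  degree-++ v es fs = trans (cong (occ v) (endpoints-++ es fs)) (occ-++ v (endpoints es) (endpoints fs))

  degree-↭ : ∀ v {es fs} → es ↭ fs → degree v es ≡ degree v fs
  degree-↭ v p = occ-↭ v (endpoints-↭ p)

  hasEnd⇒occ≥1 : ∀ u e → hasEnd u e ≡ true → 1 ≤ occ u (edgeEnds e)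
  hasEnd⇒occ≥1 u (i , _ , j) h with u ≡ᵇ i | u ≡ᵇ j
  ... | true  | _     = s≤s z≤n
  ... | false | true  = s≤s z≤n

  ¬hasEnd⇒occ≡0 : ∀ u e → hasEnd u e ≡ false → occ u (edgeEnds e) ≡ 0
  ¬hasEnd⇒occ≡0 u (i , _ , j) h with u ≡ᵇ i | u ≡ᵇ j
  ... | false | false = refl

  hasEnd⇒endpoint : ∀ u i w j → hasEnd u (i , w , j) ≡ true → (u ≡ i) ⊎ (u ≡ j)
  hasEnd⇒endpoint u i w j h with u ≡ᵇ i in e | u ≡ᵇ j in e′
  ... | true  | _    = inj₁ (≡ᵇ≡true⇒≡ u i e)
  ... | false | true = inj₂ (≡ᵇ≡true⇒≡ u j e′)

  hasEnd-start : ∀ u w j → hasEnd u (u , w , j) ≡ true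
  hasEnd-start u w j rewrite ≡ᵇ-refl u = refl

  hasEnd-end : ∀ u i w → hasEnd u (i , w , u) ≡ true
  hasEnd-end u i w rewrite ≡ᵇ-refl u with u ≡ᵇ i
  ... | true = refl
  ... | false = refl

  ∈⇒degree≥1 : ∀ u {e es} → e ∈ es → hasEnd u e ≡ true → 1 ≤ degree u es
  ∈⇒degree≥1 u {e} {_ ∷ es} (here refl) h rewrite degree-∷ u e es = ≤-trans (hasEnd⇒occ≥1 u e h) (m≤m+n _ _)
  ∈⇒degree≥1 u {es = e′ ∷ es} (there p) h rewrite degree-∷ u e′ es = ≤-trans (∈⇒degree≥1 u p h) (m≤n+m _ _)

  degree≥1⇒∈ : ∀ u es → 1 ≤ degree u es → ∃ λ e → e ∈ es × hasEnd u e ≡ true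
  degree≥1⇒∈ u (e ∷ es) d with hasEnd u e in h
  ... | true = e , here refl , h
  ... | false rewrite degree-∷ u e es | ¬hasEnd⇒occ≡0 u e h with degree≥1⇒∈ u es d
  ... | e′ , e′∈es , h′ = e′ , there e′∈es , h′

  two-edges⇒degree≢1 : ∀ u e {e′} es → hasEnd u e ≡ true → hasEnd u e′ ≡ true → e′ ∈ es →
    degree u (e ∷ es) ≢ 1
  two-edges⇒degree≢1 u e es h h′ q d = <-irrefl refl (begin
    2                                  ≤⟨ +-mono-≤ (hasEnd⇒occ≥1 u e h) (∈⇒degree≥1 u q h′) ⟩
    occ u (edgeEnds e) + degree u es   ≡⟨ sym (degree-∷ u e es) ⟩
    degree u (e ∷ es)                  ≡⟨ d ⟩
    1                                  ∎)
    where open ≤-Reasoning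

  edge-at-unique : ∀ u {e e′ es} → e ∈ es → e′ ∈ es → hasEnd u e ≡ true → hasEnd u e′ ≡ true →
    degree u es ≡ 1 → e ≡ e′
  edge-at-unique u (here refl) (here refl) h h′ d = refl
  edge-at-unique u {e} {es = _ ∷ es} (here refl) (there q) h h′ d = ⊥-elim (two-edges⇒degree≢1 u e es h h′ q d)
  edge-at-unique u {e′ = e′} {_ ∷ es} (there p) (here refl) h h′ d = ⊥-elim (two-edges⇒degree≢1 u e′ es h′ h p d)
  edge-at-unique u {es = x ∷ es} (there p) (there q) h h′ d =
    edge-at-unique u p q h h′ (≤-antisym (subst (degree u es ≤_) d′ (m≤n+m _ _)) (∈⇒degree≥1 u p h))
    where
      d′ : occ u (edgeEnds x) + degree u es ≡ 1
      d′ = trans (sym (degree-∷ u x es)) d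

  pick-sound : ∀ u es {e r} → pick u es ≡ just (e , r) → (es ↭ e ∷ r) × (hasEnd u e ≡ true)
  pick-sound u (x ∷ es) eq with hasEnd u x in h
  pick-sound u (x ∷ es) refl | true = refl , h
  ... | false with pick u es in eq′
  pick-sound u (x ∷ es) refl | false | just (e , r) with pick-sound u es eq′
  ... | p , h′ = ↭-trans (prep x p) (swap x e refl) , h′

  pick≡nothing⇒degree≡0 : ∀ u es → pick u es ≡ nothing → degree u es ≡ 0
  pick≡nothing⇒degree≡0 u [] eq = refl
  pick≡nothing⇒degree≡0 u (x ∷ es) eq with hasEnd u x in h
  pick≡nothing⇒degree≡0 u (x ∷ es) () | true
  ... | false with pick u es in eq′
  pick≡nothing⇒degree≡0 u (x ∷ es) refl | false | nothing
    rewrite degree-∷ u x es | ¬hasEnd⇒occ≡0 u x h = pick≡nothing⇒degree≡0 u es eq′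

  Directed : Boundary → List Edge → Set
  Directed X = All (EdgeOK X)

  polarities-differ⇒≢ : ∀ X {a b x y} → at X a ≡ just x → at X b ≡ just y → x ≢ y → a ≢ b
  polarities-differ⇒≢ X pa pb x≢y refl = x≢y (just-injective (trans (sym pa) pb))

  ∈-↭⁻ : ∀ {e : Edge} {es fs} → es ↭ fs → e ∈ fs → e ∈ es
  ∈-↭⁻ p = ∈-resp-↭ (↭-sym p)

  degree≡1⇒pick≢nothing : ∀ u es → degree u es ≡ 1 → pick u es ≢ nothing
  degree≡1⇒pick≢nothing u es d eq with trans (sym d) (pick≡nothing⇒degree≡0 u es eq)
  ... | ()

  data GluedAtRightEnd (u v : ℕ) (es : List Edge) (cs : List Word) (res : RawMW) : Set where
    cycle : ∀ w R → es ↭ (v , w , u) ∷ R → res ≡ mw R (w ∷ cs) → GluedAtRightEnd u v es cs res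
    path  : ∀ i w₁ w₂ j R → es ↭ (i , w₁ , u) ∷ (v , w₂ , j) ∷ R →
            res ≡ mw ((i , w₁ ++ w₂ , j) ∷ R) cs → GluedAtRightEnd u v es cs res

  data GluedAtLeftEnd (u v : ℕ) (es : List Edge) (cs : List Word) (res : RawMW) : Set where
    cycle : ∀ w R → es ↭ (u , w , v) ∷ R → res ≡ mw R (w ∷ cs) → GluedAtLeftEnd u v es cs res
    path  : ∀ j w₁ i w₂ R → es ↭ (u , w₁ , j) ∷ (i , w₂ , v) ∷ R →
            res ≡ mw ((i , w₂ ++ w₁ , j) ∷ R) cs → GluedAtLeftEnd u v es cs res

  glue1-atRightEnd : ∀ X u v es cs → Directed X es → degree u es ≡ 1 → degree v es ≡ 1 →
    at X u ≡ just false → at X v ≡ just true → GluedAtRightEnd u v es cs (glue1 u v (mw es cs))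
  glue1-atRightEnd X u v es cs D du dv pu pv with pick u es in eq
  ... | nothing = ⊥-elim (degree≡1⇒pick≢nothing u es du eq)
  ... | just ((i₁ , w₁ , j₁) , rest) with pick-sound u es eq
  ... | es↭ , h with All.lookup D (∈-↭⁻ es↭ (here refl)) | hasEnd⇒endpoint u i₁ w₁ j₁ h
  ... | pi₁ , _ | inj₁ refl = ⊥-elim (polarities-differ⇒≢ X pu pi₁ (λ ()) refl)
  ... | pi₁ , _ | inj₂ refl
    rewrite ≢⇒≡ᵇ≡false i₁ u (polarities-differ⇒≢ X pi₁ pu (λ ())) | ≡ᵇ-refl u
    with i₁ ≡ᵇ v in i₁≟v
  ... | true with ≡ᵇ≡true⇒≡ i₁ v i₁≟v
  ...   | refl = cycle w₁ rest es↭ refl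
  glue1-atRightEnd X u v es cs D du dv pu pv | just ((i₁ , w₁ , u) , rest) | es↭ , h | pi₁ , _ | inj₂ refl | false
    with pick v rest in eq′
  ... | nothing = ⊥-elim (degree≡1⇒pick≢nothing v rest dv′ eq′)
    where
      dv′ : degree v rest ≡ 1
      dv′ = trans (sym (trans (degree-↭ v es↭)
                  (occ-pair-other i₁ u (endpoints rest) (λ e → ≡ᵇ≡false⇒≢ i₁ v i₁≟v (sym e))
                                                         (polarities-differ⇒≢ X pv pu (λ ()))))) dv
  ... | just ((i₂ , w₂ , j₂) , rest′) with pick-sound v rest eq′
  ... | rest↭ , h′ with All.lookup D (∈-↭⁻ es↭ (there (∈-↭⁻ rest↭ (here refl)))) | hasEnd⇒endpoint v i₂ w₂ j₂ h′
  ... | _ , pj₂ | inj₂ refl = ⊥-elim (polarities-differ⇒≢ X pv pj₂ (λ ()) refl)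
  ... | _ | inj₁ refl rewrite ≡ᵇ-refl v | ≡ᵇ-refl u =
    path i₁ w₁ w₂ j₂ rest′ (↭-trans es↭ (prep _ rest↭)) refl

  glue1-atLeftEnd : ∀ X u v es cs → Directed X es → degree u es ≡ 1 → degree v es ≡ 1 →
    at X u ≡ just true → at X v ≡ just false → GluedAtLeftEnd u v es cs (glue1 u v (mw es cs))
  glue1-atLeftEnd X u v es cs D du dv pu pv with pick u es in eq
  ... | nothing = ⊥-elim (degree≡1⇒pick≢nothing u es du eq)
  ... | just ((i₁ , w₁ , j₁) , rest) with pick-sound u es eq
  ... | es↭ , h with All.lookup D (∈-↭⁻ es↭ (here refl)) | hasEnd⇒endpoint u i₁ w₁ j₁ h
  ... | _ , pj₁ | inj₂ refl = ⊥-elim (polarities-differ⇒≢ X pu pj₁ (λ ()) refl)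
  ... | _ , pj₁ | inj₁ refl
    rewrite ≢⇒≡ᵇ≡false j₁ u (polarities-differ⇒≢ X pj₁ pu (λ ())) | ≡ᵇ-refl u
          | ≢⇒≡ᵇ≡false u v (polarities-differ⇒≢ X pu pv (λ ()))
    with j₁ ≡ᵇ v in j₁≟v
  ... | true with ≡ᵇ≡true⇒≡ j₁ v j₁≟v
  ...   | refl = cycle w₁ rest es↭ refl
  glue1-atLeftEnd X u v es cs D du dv pu pv | just ((u , w₁ , j₁) , rest) | es↭ , h | _ , pj₁ | inj₁ refl | false
    with pick v rest in eq′
  ... | nothing = ⊥-elim (degree≡1⇒pick≢nothing v rest dv′ eq′)
    where
      dv′ : degree v rest ≡ 1
      dv′ = trans (sym (trans (degree-↭ v es↭)
                  (occ-pair-other u j₁ (endpoints rest) (polarities-differ⇒≢ X pv pu (λ ()))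
                                                         (λ e → ≡ᵇ≡false⇒≢ j₁ v j₁≟v (sym e))))) dv
  ... | just ((i₂ , w₂ , j₂) , rest′) with pick-sound v rest eq′
  ... | rest↭ , h′ with All.lookup D (∈-↭⁻ es↭ (there (∈-↭⁻ rest↭ (here refl)))) | hasEnd⇒endpoint v i₂ w₂ j₂ h′
  ... | pi₂ , _ | inj₁ refl = ⊥-elim (polarities-differ⇒≢ X pv pi₂ (λ ()) refl)
  ... | _ | inj₂ refl
    rewrite ≡ᵇ-refl v | ≡ᵇ-refl u | ≢⇒≡ᵇ≡false j₁ u (polarities-differ⇒≢ X pj₁ pu (λ ())) =
    path j₁ w₁ i₂ w₂ rest′ (↭-trans es↭ (prep _ rest↭)) refl

  glue1-consumes : ∀ X u v b es cs → Directed X es → degree u es ≡ 1 → degree v es ≡ 1 →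
    at X u ≡ just b → at X v ≡ just (not b) →
    Directed X (edges (glue1 u v (mw es cs))) × (endpoints es ↭ u ∷ v ∷ endpoints (edges (glue1 u v (mw es cs))))
  glue1-consumes X u v false es cs D du dv pu pv with glue1-atRightEnd X u v es cs D du dv pu pv
  ... | cycle w R p e rewrite e = All.tail (All-resp-↭ p D) , ↭-trans (endpoints-↭ p) (swap v u refl)
  ... | path i w₁ w₂ j R p e rewrite e with All-resp-↭ p D
  ... | (pi , _) ∷ (_ , pj) ∷ DR =
    (pi , pj) ∷ DR , ↭-trans (endpoints-↭ p) (↭-trans (swap i u refl) (prep u (swap i v refl)))
  glue1-consumes X u v true es cs D du dv pu pv with glue1-atLeftEnd X u v es cs D du dv pu pv
  ... | cycle w R p e rewrite e = All.tail (All-resp-↭ p D) , endpoints-↭ p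
  ... | path j w₁ i w₂ R p e rewrite e with All-resp-↭ p D
  ... | (_ , pj) ∷ (pi , _) ∷ DR =
    (pi , pj) ∷ DR , ↭-trans (endpoints-↭ p) (prep u (↭-trans (swap j i refl) (↭-trans (prep i (swap j v refl)) (swap i v refl))))

  -- Interpretations of derivations are multiwords

  relabelEdge : (ℕ → ℕ) → Edge → Edge
  relabelEdge f (i , w , j) = f i , w , f j

  endpoints-relabel : ∀ f r → endpoints (edges (relabel f r)) ≡ map f (endpoints (edges r))
  endpoints-relabel f (mw [] cs) = refl
  endpoints-relabel f (mw ((i , w , j) ∷ es) cs) = cong (λ ns → f i ∷ f j ∷ ns) (endpoints-relabel f (mw es cs))

  relabel-directed : ∀ X Y f r → Directed X (edges r) →
    (∀ x → x ∈ endpoints (edges r) → at Y (f x) ≡ at X x) → Directed Y (edges (relabel f r))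
  relabel-directed X Y f (mw [] cs) [] h = []
  relabel-directed X Y f (mw ((i , w , j) ∷ es) cs) ((pi , pj) ∷ D) h =
    (trans (h i (here refl)) pi , trans (h j (there (here refl))) pj)
    ∷ relabel-directed X Y f (mw es cs) D (λ x x∈ → h x (there (there x∈)))

  endpoint<length : ∀ X es {x} → Directed X es → x ∈ endpoints es → x < length X
  endpoint<length X ((i , w , j) ∷ es) ((pi , pj) ∷ D) (here refl) = at⇒< X i pi
  endpoint<length X ((i , w , j) ∷ es) ((pi , pj) ∷ D) (there (here refl)) = at⇒< X j pj
  endpoint<length X ((i , w , j) ∷ es) (_ ∷ D) (there (there x∈)) = endpoint<length X es D x∈

  relabel-bijection-valid : ∀ X Y (f g : ℕ → ℕ) r → IsMultiword X r → (∀ x → at Y (f x) ≡ at X x) →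
    (∀ x → g (f x) ≡ x) → (∀ y → f (g y) ≡ y) → IsMultiword Y (relabel f r)
  relabel-bijection-valid X Y f g r V polarity g∘f f∘g = record
    { directed = relabel-directed X Y f r (IsMultiword.directed V) (λ x _ → polarity x)
    ; perfect = λ y y< → begin
        occ y (endpoints (edges (relabel f r)))   ≡⟨ cong (occ y) (endpoints-relabel f r) ⟩
        occ y (map f E)                           ≡⟨ occ-map-injective f-injective E (f∘g y) ⟩
        occ (g y) E                               ≡⟨ IsMultiword.perfect V (g y) (g-bound y y<) ⟩
        1                                         ∎ }
    where
      open ≡-Reasoning
      E = endpoints (edges r)
      f-injective : ∀ {x y} → f x ≡ f y → x ≡ y
      f-injective {x} {y} e = trans (sym (g∘f x)) (trans (cong g e) (g∘f y))
      g-bound : ∀ y → y < length Y → g y < length X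
      g-bound y y< with <⇒at Y y y<
      ... | _ , at-y = at⇒< X (g y) (trans (sym (polarity (g y))) (trans (cong (at Y) (f∘g y)) at-y))

  degree-relabel-union : ∀ v f g p q → degree v (edges (union (relabel f p) (relabel g q))) ≡
    occ v (map f (endpoints (edges p))) + occ v (map g (endpoints (edges q)))
  degree-relabel-union v f g p q = trans (degree-++ v (edges (relabel f p)) (edges (relabel g q)))
    (cong₂ _+_ (cong (occ v) (endpoints-relabel f p)) (cong (occ v) (endpoints-relabel g q)))

  module Tensor (D A B G : Boundary) where
    d = length D
    a = length A
    b = length B
    g = length G
    Y = D ++ (A ++ (B ++ G))

    -- the relabellings of the two premises in tensorRaw
    fp fq : ℕ → ℕ
    fp v = if v <ᵇ a then v + d else v + d + b
    fq v = if v <ᵇ d then v else v + a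

    fp-lo : ∀ {x} → x < a → fp x ≡ x + d
    fp-lo x<a rewrite <⇒<ᵇ≡true x<a = refl
    fp-hi : ∀ {x} → a ≤ x → fp x ≡ x + d + b
    fp-hi a≤x rewrite ≥⇒<ᵇ≡false a≤x = refl
    fq-lo : ∀ {x} → x < d → fq x ≡ x
    fq-lo x<d rewrite <⇒<ᵇ≡true x<d = refl
    fq-hi : ∀ {x} → d ≤ x → fq x ≡ x + a
    fq-hi d≤x rewrite ≥⇒<ᵇ≡false d≤x = refl

    fp-lo<fp-hi : ∀ {x y} → x < a → a ≤ y → fp x < fp y
    fp-lo<fp-hi {x} {y} x<a a≤y rewrite fp-lo x<a | fp-hi a≤y =
      <-≤-trans (+-monoˡ-< d (<-≤-trans x<a a≤y)) (m≤m+n (y + d) b)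

    fq-lo<fq-hi : ∀ {x y} → x < d → d ≤ y → fq x < fq y
    fq-lo<fq-hi {x} {y} x<d d≤y rewrite fq-lo x<d | fq-hi d≤y = <-≤-trans x<d (≤-trans d≤y (m≤m+n y a))

    fp-injective : ∀ {x y} → fp x ≡ fp y → x ≡ y
    fp-injective {x} {y} e with x <? a | y <? a
    ... | yes x<a | yes y<a = +-cancelʳ-≡ d x y (trans (sym (fp-lo x<a)) (trans e (fp-lo y<a)))
    ... | yes x<a | no y≮a = ⊥-elim (<⇒≢ (fp-lo<fp-hi x<a (≮⇒≥ y≮a)) e)
    ... | no x≮a | yes y<a = ⊥-elim (<⇒≢ (fp-lo<fp-hi y<a (≮⇒≥ x≮a)) (sym e))
    ... | no x≮a | no y≮a = +-cancelʳ-≡ d x y (+-cancelʳ-≡ b (x + d) (y + d)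
                              (trans (sym (fp-hi (≮⇒≥ x≮a))) (trans e (fp-hi (≮⇒≥ y≮a)))))

    fq-injective : ∀ {x y} → fq x ≡ fq y → x ≡ y
    fq-injective {x} {y} e with x <? d | y <? d
    ... | yes x<d | yes y<d = trans (sym (fq-lo x<d)) (trans e (fq-lo y<d))
    ... | yes x<d | no y≮d = ⊥-elim (<⇒≢ (fq-lo<fq-hi x<d (≮⇒≥ y≮d)) e)
    ... | no x≮d | yes y<d = ⊥-elim (<⇒≢ (fq-lo<fq-hi y<d (≮⇒≥ x≮d)) (sym e))
    ... | no x≮d | no y≮d = +-cancelʳ-≡ a x y (trans (sym (fq-hi (≮⇒≥ x≮d))) (trans e (fq-hi (≮⇒≥ y≮d))))

    at-fp : ∀ x → at Y (fp x) ≡ at (A ++ G) x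
    at-fp x with <⊎≥ a x
    ... | inj₁ x<a = begin
      at Y (fp x)                  ≡⟨ cong (at Y) (trans (fp-lo x<a) (+-comm x d)) ⟩
      at Y (d + x)                 ≡⟨ at-++ʳ D _ x ⟩
      at (A ++ (B ++ G)) x         ≡⟨ at-++ˡ A _ x x<a ⟩
      at A x                       ≡⟨ sym (at-++ˡ A G x x<a) ⟩
      at (A ++ G) x                ∎
      where open ≡-Reasoning
    ... | inj₂ (r , refl) = begin
      at Y (fp (a + r))            ≡⟨ cong (at Y) (trans (fp-hi (m≤m+n a r)) (rearrange a r d b)) ⟩
      at Y (d + (a + (b + r)))     ≡⟨ at-++ʳ D _ _ ⟩
      at (A ++ (B ++ G)) (a + (b + r)) ≡⟨ at-++ʳ A _ _ ⟩
      at (B ++ G) (b + r)          ≡⟨ at-++ʳ B _ _ ⟩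
      at G r                       ≡⟨ sym (at-++ʳ A G r) ⟩
      at (A ++ G) (a + r)          ∎
      where
        open ≡-Reasoning
        rearrange : ∀ a r d b → a + r + d + b ≡ d + (a + (b + r))
        rearrange = solve-∀

    at-fq : ∀ x → x < d + b → at Y (fq x) ≡ at (D ++ B) x
    at-fq x x< with <⊎≥ d x
    ... | inj₁ x<d = begin
      at Y (fq x)                  ≡⟨ cong (at Y) (fq-lo x<d) ⟩
      at Y x                       ≡⟨ at-++ˡ D _ x x<d ⟩
      at D x                       ≡⟨ sym (at-++ˡ D B x x<d) ⟩
      at (D ++ B) x                ∎
      where open ≡-Reasoning
    ... | inj₂ (r , refl) = begin
      at Y (fq (d + r))            ≡⟨ cong (at Y) (trans (fq-hi (m≤m+n d r)) (+-assoc d r a)) ⟩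
      at Y (d + (r + a))           ≡⟨ cong (λ z → at Y (d + z)) (+-comm r a) ⟩
      at Y (d + (a + r))           ≡⟨ at-++ʳ D _ _ ⟩
      at (A ++ (B ++ G)) (a + r)   ≡⟨ at-++ʳ A _ _ ⟩
      at (B ++ G) r                ≡⟨ at-++ˡ B G r (+-cancelˡ-< d r b x<) ⟩
      at B r                       ≡⟨ sym (at-++ʳ D B r) ⟩
      at (D ++ B) (d + r)          ∎
      where open ≡-Reasoning

    fp≥d : ∀ x → d ≤ fp x
    fp≥d x with x <? a
    ... | yes x<a rewrite fp-lo x<a = m≤n+m d x
    ... | no x≮a rewrite fp-hi (≮⇒≥ x≮a) = ≤-trans (m≤n+m d x) (m≤m+n (x + d) b)

    fp-avoids-B : ∀ x → fp x < d + a ⊎ d + a + b ≤ fp x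
    fp-avoids-B x with x <? a
    ... | yes x<a rewrite fp-lo x<a = inj₁ (subst (x + d <_) (+-comm a d) (+-monoˡ-< d x<a))
    ... | no x≮a rewrite fp-hi (≮⇒≥ x≮a) =
      inj₂ (+-monoˡ-≤ b (subst (_≤ x + d) (+-comm a d) (+-monoˡ-≤ d (≮⇒≥ x≮a))))

    fq-avoids-A : ∀ x → fq x < d ⊎ d + a ≤ fq x
    fq-avoids-A x with x <? d
    ... | yes x<d rewrite fq-lo x<d = inj₁ x<d
    ... | no x≮d rewrite fq-hi (≮⇒≥ x≮d) = inj₂ (+-monoˡ-≤ a (≮⇒≥ x≮d))

    fq-below-G : ∀ x → x < d + b → fq x < d + a + b
    fq-below-G x x< with x <? d
    ... | yes x<d rewrite fq-lo x<d = <-≤-trans x<d (≤-trans (m≤m+n d a) (m≤m+n (d + a) b))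
    ... | no x≮d rewrite fq-hi (≮⇒≥ x≮d) = subst (x + a <_) (rearrange d b a) (+-monoˡ-< a x<)
      where
        rearrange : ∀ d b a → d + b + a ≡ d + a + b
        rearrange = solve-∀

    length-Y : length Y ≡ d + (a + (b + g))
    length-Y = trans (length-++ D) (cong (d +_) (trans (length-++ A) (cong (a +_) (length-++ B))))

    module _ (p q : RawMW) (P : IsMultiword (A ++ G) p) (Q : IsMultiword (D ++ B) q) where
      private
        Ep = endpoints (edges p)
        Eq = endpoints (edges q)

        q-bound : ∀ {x} → x ∈ Eq → x < d + b
        q-bound x∈ = subst (_ <_) (length-++ D) (endpoint<length (D ++ B) (edges q) (IsMultiword.directed Q) x∈)

        perfect-p : ∀ x → x < a + g → occ x Ep ≡ 1
        perfect-p x x< = IsMultiword.perfect P x (subst (x <_) (sym (length-++ A)) x<)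

        perfect-q : ∀ x → x < d + b → occ x Eq ≡ 1
        perfect-q x x< = IsMultiword.perfect Q x (subst (x <_) (sym (length-++ D)) x<)

      degree-in-D : ∀ {v} → v < d → occ v (map fp Ep) + occ v (map fq Eq) ≡ 1
      degree-in-D {v} v<d = trans
        (cong₂ _+_ (occ-map-∉ fp v Ep (λ x _ e → <⇒≱ v<d (subst (d ≤_) e (fp≥d x))))
                   (occ-map-injective fq-injective Eq (fq-lo v<d)))
        (perfect-q v (<-≤-trans v<d (m≤m+n d b)))

      degree-in-A : ∀ {r} → r < a → occ (d + r) (map fp Ep) + occ (d + r) (map fq Eq) ≡ 1
      degree-in-A {r} r<a = trans
        (cong₂ _+_ (occ-map-injective fp-injective Ep (trans (fp-lo r<a) (+-comm r d)))
                   (occ-map-∉ fq (d + r) Eq (λ x _ → fq≢ x)))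
        (trans (+-identityʳ _) (perfect-p r (<-≤-trans r<a (m≤m+n a g))))
        where
          fq≢ : ∀ x → fq x ≢ d + r
          fq≢ x with fq-avoids-A x
          ... | inj₁ fq<d = <⇒≢ (<-≤-trans fq<d (m≤m+n d r))
          ... | inj₂ d+a≤ = λ e → <⇒≱ (+-monoʳ-< d r<a) (subst (d + a ≤_) e d+a≤)

      degree-in-B : ∀ {r} → r < b → occ (d + a + r) (map fp Ep) + occ (d + a + r) (map fq Eq) ≡ 1
      degree-in-B {r} r<b = trans
        (cong₂ _+_ (occ-map-∉ fp (d + a + r) Ep (λ x _ → fp≢ x))
                   (occ-map-injective fq-injective Eq (trans (fq-hi (m≤m+n d r)) (rearrange d r a))))
        (perfect-q (d + r) (+-monoʳ-< d r<b))
        where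
          rearrange : ∀ d r a → d + r + a ≡ d + a + r
          rearrange = solve-∀
          fp≢ : ∀ x → fp x ≢ d + a + r
          fp≢ x with fp-avoids-B x
          ... | inj₁ fp< = <⇒≢ (<-≤-trans fp< (m≤m+n (d + a) r))
          ... | inj₂ d+a+b≤ = λ e → <⇒≱ (+-monoʳ-< (d + a) r<b) (subst (d + a + b ≤_) e d+a+b≤)

      degree-in-G : ∀ {r} → r < g → occ (d + a + b + r) (map fp Ep) + occ (d + a + b + r) (map fq Eq) ≡ 1
      degree-in-G {r} r<g = trans
        (cong₂ _+_ (occ-map-injective fp-injective Ep (trans (fp-hi (m≤m+n a r)) (rearrange a r d b)))
                   (occ-map-∉ fq (d + a + b + r) Eq (λ x x∈ → <⇒≢ (<-≤-trans (fq-below-G x (q-bound x∈)) (m≤m+n _ r)))))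
        (trans (+-identityʳ _) (perfect-p (a + r) (+-monoʳ-< a r<g)))
        where
          rearrange : ∀ a r d b → a + r + d + b ≡ d + a + b + r
          rearrange = solve-∀

      tensor-valid : IsMultiword Y (tensorRaw d a b p q)
      tensor-valid = record
        { directed = ++⁺ (relabel-directed (A ++ G) Y fp p (IsMultiword.directed P) (λ x _ → at-fp x))
                         (relabel-directed (D ++ B) Y fq q (IsMultiword.directed Q) (λ x x∈ → at-fq x (q-bound x∈)))
        ; perfect = λ v v< → trans (degree-relabel-union v fp fq p q) (perfect v v<) }
        where
          perfect : ∀ v → v < length Y → occ v (map fp Ep) + occ v (map fq Eq) ≡ 1
          perfect v v< with blocks d a b v
          ... | front v<d = degree-in-D v<d
          ... | first r<a = degree-in-A r<a
          ... | second r<b = degree-in-B r<b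
          ... | back r = degree-in-G (+-cancelˡ-< (d + a + b) r g (subst (d + a + b + r <_) (rearrange d a b g) (subst (_ <_) length-Y v<)))
            where
              rearrange : ∀ d a b g → d + (a + (b + g)) ≡ d + a + b + g
              rearrange = solve-∀

  module _ (d b a : ℕ) where

    swapBlocks-front : ∀ {x} → x < d → swapBlocks d b a x ≡ x
    swapBlocks-front x<d rewrite <⇒<ᵇ≡true x<d = refl

    swapBlocks-first : ∀ {r} → r < b → swapBlocks d b a (d + r) ≡ d + a + r
    swapBlocks-first {r} r<b
      rewrite ≥⇒<ᵇ≡false (m≤m+n d r) | <⇒<ᵇ≡true (+-monoʳ-< d r<b) = rearrange d r a
      where
        rearrange : ∀ d r a → d + r + a ≡ d + a + r
        rearrange = solve-∀

    swapBlocks-second : ∀ {r} → r < a → swapBlocks d b a (d + b + r) ≡ d + r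
    swapBlocks-second {r} r<a
      rewrite ≥⇒<ᵇ≡false (≤-trans (m≤m+n d b) (m≤m+n (d + b) r)) | ≥⇒<ᵇ≡false (m≤m+n (d + b) r)
            | <⇒<ᵇ≡true (+-monoʳ-< (d + b) r<a) = trans (cong (_∸ b) (rearrange d b r)) (m+n∸n≡m (d + r) b)
      where
        rearrange : ∀ d b r → d + b + r ≡ d + r + b
        rearrange = solve-∀

    swapBlocks-back : ∀ r → swapBlocks d b a (d + b + a + r) ≡ d + b + a + r
    swapBlocks-back r
      rewrite ≥⇒<ᵇ≡false (≤-trans (≤-trans (m≤m+n d b) (m≤m+n (d + b) a)) (m≤m+n (d + b + a) r))
            | ≥⇒<ᵇ≡false (≤-trans (m≤m+n (d + b) a) (m≤m+n (d + b + a) r))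
            | ≥⇒<ᵇ≡false (m≤m+n (d + b + a) r) = refl

  swapBlocks-involutive : ∀ d b a x → swapBlocks d a b (swapBlocks d b a x) ≡ x
  swapBlocks-involutive d b a x with blocks d b a x
  ... | front x<d rewrite swapBlocks-front d b a x<d = swapBlocks-front d a b x<d
  ... | first r<b rewrite swapBlocks-first d b a r<b = swapBlocks-second d a b r<b
  ... | second r<a rewrite swapBlocks-second d b a r<a = swapBlocks-first d a b r<a
  ... | back r rewrite swapBlocks-back d b a r =
    trans (cong (swapBlocks d a b) (rearrange d b a r)) (trans (swapBlocks-back d a b r) (sym (rearrange d b a r)))
    where
      rearrange : ∀ d b a r → d + b + a + r ≡ d + a + b + r
      rearrange = solve-∀

  at-swapBlocks : ∀ D B A G x → at (D ++ (A ++ (B ++ G))) (swapBlocks (length D) (length B) (length A) x) ≡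
                                at (D ++ (B ++ (A ++ G))) x
  at-swapBlocks D B A G x with blocks (length D) (length B) (length A) x
  ... | front x<d rewrite swapBlocks-front (length D) (length B) (length A) x<d = trans (at-++ˡ D _ x x<d) (sym (at-++ˡ D _ x x<d))
  ... | first {r} r<b rewrite swapBlocks-first (length D) (length B) (length A) r<b = begin
    at (D ++ (A ++ (B ++ G))) (length D + length A + r)   ≡⟨ cong (at (D ++ _)) (+-assoc (length D) (length A) r) ⟩
    at (D ++ (A ++ (B ++ G))) (length D + (length A + r)) ≡⟨ at-++ʳ D _ _ ⟩
    at (A ++ (B ++ G)) (length A + r)                     ≡⟨ at-++ʳ A _ _ ⟩
    at (B ++ G) r                                         ≡⟨ at-++ˡ B G r r<b ⟩
    at B r                                                ≡⟨ sym (at-++ˡ B _ r r<b) ⟩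
    at (B ++ (A ++ G)) r                                  ≡⟨ sym (at-++ʳ D _ r) ⟩
    at (D ++ (B ++ (A ++ G))) (length D + r)              ∎
    where open ≡-Reasoning
  ... | second {r} r<a rewrite swapBlocks-second (length D) (length B) (length A) r<a = begin
    at (D ++ (A ++ (B ++ G))) (length D + r)              ≡⟨ at-++ʳ D _ _ ⟩
    at (A ++ (B ++ G)) r                                  ≡⟨ at-++ˡ A _ r r<a ⟩
    at A r                                                ≡⟨ sym (at-++ˡ A G r r<a) ⟩
    at (A ++ G) r                                         ≡⟨ sym (at-++ʳ B _ r) ⟩
    at (B ++ (A ++ G)) (length B + r)                     ≡⟨ sym (at-++ʳ D _ _) ⟩
    at (D ++ (B ++ (A ++ G))) (length D + (length B + r)) ≡⟨ cong (at (D ++ _)) (sym (+-assoc (length D) (length B) r)) ⟩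
    at (D ++ (B ++ (A ++ G))) (length D + length B + r)   ∎
    where open ≡-Reasoning
  ... | back r rewrite swapBlocks-back (length D) (length B) (length A) r = begin
    at (D ++ (A ++ (B ++ G))) (length D + length B + length A + r)     ≡⟨ cong (at (D ++ _)) (rearrange (length D) (length B) (length A) r) ⟩
    at (D ++ (A ++ (B ++ G))) (length D + (length A + (length B + r))) ≡⟨ at-++ʳ D _ _ ⟩
    at (A ++ (B ++ G)) (length A + (length B + r))                     ≡⟨ at-++ʳ A _ _ ⟩
    at (B ++ G) (length B + r)                                         ≡⟨ at-++ʳ B _ _ ⟩
    at G r                                                             ≡⟨ sym (at-++ʳ A _ _) ⟩
    at (A ++ G) (length A + r)                                         ≡⟨ sym (at-++ʳ B _ _) ⟩
    at (B ++ (A ++ G)) (length B + (length A + r))                     ≡⟨ sym (at-++ʳ D _ _) ⟩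
    at (D ++ (B ++ (A ++ G))) (length D + (length B + (length A + r))) ≡⟨ cong (at (D ++ _)) (sym (+-assoc (length D) (length B) _)) ⟩
    at (D ++ (B ++ (A ++ G))) (length D + length B + (length A + r))   ≡⟨ cong (at (D ++ _)) (sym (+-assoc (length D + length B) (length A) r)) ⟩
    at (D ++ (B ++ (A ++ G))) (length D + length B + length A + r)     ∎
    where
      open ≡-Reasoning
      rearrange : ∀ d b a r → d + b + a + r ≡ d + (a + (b + r))
      rearrange = solve-∀

  swap-valid : ∀ D B A G r → IsMultiword (D ++ (B ++ (A ++ G))) r →
    IsMultiword (D ++ (A ++ (B ++ G))) (relabel (swapBlocks (length D) (length B) (length A)) r)
  swap-valid D B A G r V = relabel-bijection-valid _ _ _ (swapBlocks (length D) (length A) (length B)) r V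
    (at-swapBlocks D B A G) (swapBlocks-involutive (length D) (length B) (length A))
    (swapBlocks-involutive (length D) (length A) (length B))

  module Identity (X : Boundary) where
    n = length X
    Z = X ++ (X ᵇ⊥)

    mirror : ℕ → ℕ
    mirror i = (n + n) ∸ suc i

    mirror≡ : ∀ {i} → i < n → mirror i ≡ n + (n ∸ suc i)
    mirror≡ i<n = +-∸-assoc n i<n

    at-Z-lo : ∀ {i} → i < n → at Z i ≡ at X i
    at-Z-lo {i} i<n = at-++ˡ X _ i i<n

    at-Z-mirror : ∀ {i} → i < n → at Z (mirror i) ≡ Maybe.map not (at X i)
    at-Z-mirror {i} i<n = begin
      at Z (mirror i)                                   ≡⟨ cong (at Z) (mirror≡ i<n) ⟩
      at Z (n + (n ∸ suc i))                            ≡⟨ at-++ʳ X _ _ ⟩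
      at (X ᵇ⊥) (n ∸ suc i)                             ≡⟨ at-ᵇ⊥ X _ (m∸suc[n]<m i<n) ⟩
      Maybe.map not (at X (n ∸ suc (n ∸ suc i)))        ≡⟨ cong (λ j → Maybe.map not (at X j)) n∸suc[n∸suc[i]]≡i ⟩
      Maybe.map not (at X i)                            ∎
      where
        open ≡-Reasoning
        n∸suc[n∸suc[i]]≡i : n ∸ suc (n ∸ suc i) ≡ i
        n∸suc[n∸suc[i]]≡i = trans (cong (n ∸_) (sym (m∸n≡suc[m∸suc[n]] i<n))) (m∸[m∸n]≡n (<⇒≤ i<n))

    idEdges-directed : ∀ i Xs → i + length Xs ≡ n → (∀ j → at Xs j ≡ at X (i + j)) → Directed Z (idEdges n i Xs)
    idEdges-directed i [] _ _ = []
    idEdges-directed i (b ∷ Xs) e h = head b (sym (trans (h 0) (cong (at X) (+-identityʳ i))))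
      ∷ idEdges-directed (suc i) Xs (trans (sym (+-suc i _)) e) (λ j → trans (h (suc j)) (cong (at X) (+-suc i j)))
      where
        i<n : i < n
        i<n = subst (i <_) e (m<m+n i z<s)
        head : ∀ b → at X i ≡ just b →
          EdgeOK Z (if b then (i , [] , mirror i) else (mirror i , [] , i))
        head true  x = trans (at-Z-lo i<n) x , trans (at-Z-mirror i<n) (cong (Maybe.map not) x)
        head false x = trans (at-Z-mirror i<n) (cong (Maybe.map not) x) , trans (at-Z-lo i<n) x

    idEdges-degree : ∀ i Xs → i + length Xs ≡ n → ∀ v →
      (i ≤ v → v < (n + n) ∸ i → degree v (idEdges n i Xs) ≡ 1) ×
      (v < i ⊎ (n + n) ∸ i ≤ v → degree v (idEdges n i Xs) ≡ 0)
    idEdges-degree i [] e v = (λ i≤v v< → ⊥-elim (<⇒≱ v< (subst (_≤ v) (sym M∸i≡i) i≤v))) , (λ _ → refl)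
      where
        M∸i≡i : (n + n) ∸ i ≡ i
        M∸i≡i = trans (cong (λ j → (n + n) ∸ j) (trans (sym (+-identityʳ i)) e))
                      (trans (m+n∸n≡m n n) (sym (trans (sym (+-identityʳ i)) e)))
    idEdges-degree i (b ∷ Xs) e v = inside , outside
      where
        c = mirror i
        E = endpoints (idEdges n (suc i) Xs)
        IH = idEdges-degree (suc i) Xs (trans (sym (+-suc i _)) e) v
        i<n : i < n
        i<n = subst (i <_) e (m<m+n i z<s)
        M∸i≡suc[c] : (n + n) ∸ i ≡ suc c
        M∸i≡suc[c] = m∸n≡suc[m∸suc[n]] (<-≤-trans i<n (m≤m+n n n))
        i<c : i < c
        i<c = <-≤-trans i<n (subst (n ≤_) (sym (mirror≡ i<n)) (m≤m+n n _))
        endpoints-head : ∀ b → endpoints (idEdges n i (b ∷ Xs)) ↭ i ∷ c ∷ E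
        endpoints-head true = refl
        endpoints-head false = swap c i refl
        degree≡ : degree v (idEdges n i (b ∷ Xs)) ≡ occ v (i ∷ c ∷ E)
        degree≡ = occ-↭ v (endpoints-head b)
        inside : i ≤ v → v < (n + n) ∸ i → degree v (idEdges n i (b ∷ Xs)) ≡ 1
        inside i≤v v< with v ≟ i | v ≟ c
        ... | yes refl | _ = trans degree≡ (trans (occ-pair-first v c E (<⇒≢ i<c)) (cong suc (proj₂ IH (inj₁ (n<1+n v)))))
        ... | no _ | yes refl = trans degree≡ (trans (occ-pair-second i v E (>⇒≢ i<c)) (cong suc (proj₂ IH (inj₂ ≤-refl))))
        ... | no v≢i | no v≢c = trans degree≡ (trans (occ-pair-other i c E v≢i v≢c)
                (proj₁ IH (≤∧≢⇒< i≤v (≢-sym v≢i)) (≤∧≢⇒< (s≤s⁻¹ (subst (v <_) M∸i≡suc[c] v<)) v≢c)))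
        outside : v < i ⊎ (n + n) ∸ i ≤ v → degree v (idEdges n i (b ∷ Xs)) ≡ 0
        outside (inj₁ v<i) = trans degree≡ (trans (occ-pair-other i c E (<⇒≢ v<i) (<⇒≢ (<-trans v<i i<c)))
                               (proj₂ IH (inj₁ (<-trans v<i (n<1+n i)))))
        outside (inj₂ M∸i≤v) = trans degree≡ (trans (occ-pair-other i c E (>⇒≢ (<-trans i<c c<v)) (>⇒≢ c<v))
                               (proj₂ IH (inj₂ (<⇒≤ c<v))))
          where
            c<v : c < v
            c<v = subst (_≤ v) M∸i≡suc[c] M∸i≤v

    identity-valid : IsMultiword Z (idRaw X)
    identity-valid = record
      { directed = idEdges-directed 0 X refl (λ j → refl)
      ; perfect = λ v v< → proj₁ (idEdges-degree 0 X refl v) z≤n (subst (v <_) length-Z v<) }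
      where
        length-Z : length Z ≡ n + n
        length-Z = trans (length-++ X) (cong (n +_) (length-ᵇ⊥ X))

  module Cut (D A G : Boundary) where
    d = length D
    m = length A
    X = D ++ (A ++ ((A ᵇ⊥) ++ G))

    -- Step j of the trace glues vertex lo (suc j) of the [A] block to its mirror image hi j in
    -- the [A]^⊥ block, so after j steps exactly the vertices in [lo j, hi j) are used up.
    lo hi : ℕ → ℕ
    lo j = d + (m ∸ j)
    hi j = d + m + j

    gluedPair : ℕ → ℕ × ℕ
    gluedPair i = lo (suc i) , hi i

    record GluedUpTo (j : ℕ) (es : List Edge) : Set where
      field
        directed      : Directed X es
        outside-once  : ∀ w → w < length X → w < lo j ⊎ hi j ≤ w → degree w es ≡ 1
        inside-absent : ∀ w → lo j ≤ w → w < hi j → degree w es ≡ 0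
    open GluedUpTo public

    lo≡suc[lo] : ∀ {j} → j < m → lo j ≡ suc (lo (suc j))
    lo≡suc[lo] j<m = trans (cong (d +_) (m∸n≡suc[m∸suc[n]] j<m)) (+-suc d _)

    lo<hi : ∀ {j} → j < m → lo (suc j) < hi j
    lo<hi {j} j<m = <-≤-trans (+-monoʳ-< d (m∸suc[n]<m j<m)) (m≤m+n (d + m) j)

    at-lo : ∀ {j} → j < m → at X (lo (suc j)) ≡ at A (m ∸ suc j)
    at-lo {j} j<m = trans (at-++ʳ D _ (m ∸ suc j)) (at-++ˡ A _ (m ∸ suc j) (m∸suc[n]<m j<m))

    at-hi : ∀ {j} → j < m → at X (hi j) ≡ Maybe.map not (at A (m ∸ suc j))
    at-hi {j} j<m = begin
      at X (d + m + j)                   ≡⟨ cong (at X) (+-assoc d m j) ⟩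
      at X (d + (m + j))                 ≡⟨ at-++ʳ D _ (m + j) ⟩
      at (A ++ ((A ᵇ⊥) ++ G)) (m + j)    ≡⟨ at-++ʳ A _ j ⟩
      at ((A ᵇ⊥) ++ G) j                 ≡⟨ at-++ˡ (A ᵇ⊥) G j (subst (j <_) (sym (length-ᵇ⊥ A)) j<m) ⟩
      at (A ᵇ⊥) j                        ≡⟨ at-ᵇ⊥ A j j<m ⟩
      Maybe.map not (at A (m ∸ suc j))   ∎
      where open ≡-Reasoning

    glued-polarity : ∀ {j} → j < m → ∃ λ b → at X (lo (suc j)) ≡ just b × at X (hi j) ≡ just (not b)
    glued-polarity {j} j<m with <⇒at A (m ∸ suc j) (m∸suc[n]<m j<m)
    ... | b , at-b = b , trans (at-lo j<m) at-b , trans (at-hi j<m) (cong (Maybe.map not) at-b)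

    glued-degree-lo : ∀ {j es} → j < m → GluedUpTo j es → degree (lo (suc j)) es ≡ 1
    glued-degree-lo {j} j<m I with glued-polarity j<m
    ... | _ , pu , _ = outside-once I _ (at⇒< X _ pu) (inj₁ (subst (lo (suc j) <_) (sym (lo≡suc[lo] j<m)) (n<1+n _)))

    glued-degree-hi : ∀ {j es} → j < m → GluedUpTo j es → degree (hi j) es ≡ 1
    glued-degree-hi j<m I with glued-polarity j<m
    ... | _ , _ , pv = outside-once I _ (at⇒< X _ pv) (inj₂ ≤-refl)

    glued-step : ∀ {j} es cs → j < m → GluedUpTo j es → GluedUpTo (suc j) (edges (glue1 (lo (suc j)) (hi j) (mw es cs)))
    glued-step {j} es cs j<m I with glued-polarity j<m
    ... | b , pu , pv = record { directed = proj₁ spec ; outside-once = once ; inside-absent = absent }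
      where
        u = lo (suc j)
        v = hi j
        spec = glue1-consumes X u v b es cs (directed I) (glued-degree-lo j<m I) (glued-degree-hi j<m I) pu pv
        E′ = endpoints (edges (glue1 u v (mw es cs)))
        degree≡ : ∀ w → degree w es ≡ occ w (u ∷ v ∷ E′)
        degree≡ w = occ-↭ w (proj₂ spec)
        u<v = lo<hi j<m
        u<lo : u < lo j
        u<lo = subst (u <_) (sym (lo≡suc[lo] j<m)) (n<1+n u)
        hi≡suc[v] : hi (suc j) ≡ suc v
        hi≡suc[v] = +-suc (d + m) j
        once : ∀ w → w < length X → w < u ⊎ hi (suc j) ≤ w → occ w E′ ≡ 1
        once w w< (inj₁ w<u) = trans (sym (occ-pair-other u v E′ (<⇒≢ w<u) (<⇒≢ (<-trans w<u u<v))))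
                                     (trans (sym (degree≡ w)) (outside-once I w w< (inj₁ (<-trans w<u u<lo))))
        once w w< (inj₂ hi≤w) = trans (sym (occ-pair-other u v E′ (>⇒≢ (<-trans u<v v<w)) (>⇒≢ v<w)))
                                      (trans (sym (degree≡ w)) (outside-once I w w< (inj₂ (<⇒≤ v<w))))
          where
            v<w : v < w
            v<w = subst (_≤ w) hi≡suc[v] hi≤w
        absent : ∀ w → u ≤ w → w < hi (suc j) → occ w E′ ≡ 0
        absent w u≤w w< with w ≟ u | w ≟ v
        ... | yes refl | _ = suc-injective (trans (sym (occ-pair-first u v E′ (<⇒≢ u<v))) (trans (sym (degree≡ u)) (glued-degree-lo j<m I)))
        ... | no _ | yes refl = suc-injective (trans (sym (occ-pair-second u v E′ (>⇒≢ u<v))) (trans (sym (degree≡ v)) (glued-degree-hi j<m I)))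
        ... | no w≢u | no w≢v = trans (sym (occ-pair-other u v E′ w≢u w≢v)) (trans (sym (degree≡ w))
                (inside-absent I w (subst (_≤ w) (sym (lo≡suc[lo] j<m)) (≤∧≢⇒< u≤w (≢-sym w≢u)))
                                   (≤∧≢⇒< (s≤s⁻¹ (subst (w <_) hi≡suc[v] w<)) w≢v)))

    glued-range : ∀ n j r → j + n ≤ m → GluedUpTo j (edges r) → GluedUpTo (j + n) (edges (trace (map gluedPair (range j n)) r))
    glued-range zero j r _ I = subst (λ i → GluedUpTo i (edges r)) (sym (+-identityʳ j)) I
    glued-range (suc n) j r j+n≤m I = subst (λ i → GluedUpTo i (edges (trace (map gluedPair (range (suc j) n)) r′)))
      (sym (+-suc j n))
      (glued-range n (suc j) r′ (subst (_≤ m) (+-suc j n) j+n≤m)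
        (glued-step (edges r) (cycles r) (<-≤-trans (m<m+n j z<s) j+n≤m) I))
      where
        r′ = glue1 (lo (suc j)) (hi j) r

    glued-all : ∀ r → GluedUpTo 0 (edges r) → GluedUpTo m (edges (trace (map gluedPair (upTo m)) r))
    glued-all r I rewrite upTo≡range m = glued-range m 0 r ≤-refl I

    glued-initial : ∀ p q → IsMultiword (A ++ G) p → IsMultiword (D ++ (A ᵇ⊥)) q → GluedUpTo 0 (edges (tensorRaw d m m p q))
    glued-initial p q P Q = record
      { directed = IsMultiword.directed tensored
      ; outside-once = λ w w< _ → IsMultiword.perfect tensored w w<
      ; inside-absent = λ w lo≤w w<hi → ⊥-elim (<⇒≱ w<hi (subst (_≤ w) (sym (+-identityʳ (d + m))) lo≤w)) }
      where
        tensored : IsMultiword X (tensorRaw d m m p q)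
        tensored = subst (λ b → IsMultiword X (tensorRaw d m b p q)) (length-ᵇ⊥ A) (Tensor.tensor-valid D A (A ᵇ⊥) G p q P Q)

    -- collapse is the final relabelling of cutRaw; expand inverts it on the Kept vertices.
    collapse expand : ℕ → ℕ
    collapse v = if v <ᵇ d then v else v ∸ (m + m)
    expand v = if v <ᵇ d then v else v + (m + m)

    lo[m]≡d : lo m ≡ d
    lo[m]≡d = trans (cong (d +_) (n∸n≡0 m)) (+-identityʳ d)

    Kept : ℕ → Set
    Kept x = x < d ⊎ d + m + m ≤ x

    d+m+m≤⇒d≤ : ∀ {x} → d + m + m ≤ x → d ≤ x
    d+m+m≤⇒d≤ = ≤-trans (≤-trans (m≤m+n d m) (m≤m+n (d + m) m))

    d+m+m≤⇒m+m≤ : ∀ {x} → d + m + m ≤ x → m + m ≤ x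
    d+m+m≤⇒m+m≤ {x} le = ≤-trans (m≤n+m (m + m) d) (subst (_≤ x) (+-assoc d m m) le)

    expand-collapse : ∀ {x} → Kept x → expand (collapse x) ≡ x
    expand-collapse (inj₁ x<d) rewrite <⇒<ᵇ≡true x<d | <⇒<ᵇ≡true x<d = refl
    expand-collapse {x} (inj₂ le)
      rewrite ≥⇒<ᵇ≡false (d+m+m≤⇒d≤ le)
            | ≥⇒<ᵇ≡false (subst (_≤ x ∸ (m + m)) (m+n∸n≡m d (m + m)) (∸-monoˡ-≤ (m + m) (subst (_≤ x) (+-assoc d m m) le)))
      = m∸n+n≡m (d+m+m≤⇒m+m≤ le)

    collapse-expand : ∀ v → collapse (expand v) ≡ v
    collapse-expand v with v <? d
    ... | yes v<d rewrite <⇒<ᵇ≡true v<d | <⇒<ᵇ≡true v<d = refl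
    ... | no v≮d rewrite ≥⇒<ᵇ≡false (≮⇒≥ v≮d) | ≥⇒<ᵇ≡false (≤-trans (≮⇒≥ v≮d) (m≤m+n v (m + m))) = m+n∸n≡m v (m + m)

    at-collapse : ∀ {x} → Kept x → at (D ++ G) (collapse x) ≡ at X x
    at-collapse {x} (inj₁ x<d) rewrite <⇒<ᵇ≡true x<d = trans (at-++ˡ D G x x<d) (sym (at-++ˡ D _ x x<d))
    at-collapse {x} (inj₂ le) rewrite ≥⇒<ᵇ≡false (d+m+m≤⇒d≤ le) = begin
      at (D ++ G) (x ∸ (m + m))                  ≡⟨ cong (at (D ++ G)) x∸[m+m]≡d+r ⟩
      at (D ++ G) (d + r)                        ≡⟨ at-++ʳ D G r ⟩
      at G r                                     ≡⟨ sym (at-++ʳ (A ᵇ⊥) G r) ⟩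
      at ((A ᵇ⊥) ++ G) (length (A ᵇ⊥) + r)       ≡⟨ sym (at-++ʳ A _ _) ⟩
      at (A ++ ((A ᵇ⊥) ++ G)) (m + (length (A ᵇ⊥) + r)) ≡⟨ sym (at-++ʳ D _ _) ⟩
      at X (d + (m + (length (A ᵇ⊥) + r)))       ≡⟨ cong (at X) x≡ ⟩
      at X x                                     ∎
      where
        open ≡-Reasoning
        r = x ∸ (d + m + m)
        d+m+m+r≡x : d + m + m + r ≡ x
        d+m+m+r≡x = m+[n∸m]≡n le
        rearrange : ∀ d m r → d + m + m + r ≡ d + r + (m + m)
        rearrange = solve-∀
        rearrange′ : ∀ d m r → d + (m + (m + r)) ≡ d + m + m + r
        rearrange′ = solve-∀
        x∸[m+m]≡d+r : x ∸ (m + m) ≡ d + r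
        x∸[m+m]≡d+r = trans (cong (_∸ (m + m)) (trans (sym d+m+m+r≡x) (rearrange d m r))) (m+n∸n≡m (d + r) (m + m))
        x≡ : d + (m + (length (A ᵇ⊥) + r)) ≡ x
        x≡ = trans (cong (λ l → d + (m + (l + r))) (length-ᵇ⊥ A)) (trans (rearrange′ d m r) d+m+m+r≡x)

    glued-kept : ∀ {es x} → GluedUpTo m es → x ∈ endpoints es → Kept x
    glued-kept {es} {x} I x∈ with x <? d | x <? d + m + m
    ... | yes x<d | _ = inj₁ x<d
    ... | no _ | no x≮ = inj₂ (≮⇒≥ x≮)
    ... | no x≮d | yes x< = ⊥-elim (occ≡0⇒∉ (inside-absent I x (subst (_≤ x) (sym lo[m]≡d) (≮⇒≥ x≮d)) x<) x∈)

    expand-outside : ∀ v → expand v < lo m ⊎ hi m ≤ expand v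
    expand-outside v with v <? d
    ... | yes v<d rewrite <⇒<ᵇ≡true v<d = inj₁ (subst (v <_) (sym lo[m]≡d) v<d)
    ... | no v≮d rewrite ≥⇒<ᵇ≡false (≮⇒≥ v≮d) =
      inj₂ (subst (_≤ v + (m + m)) (sym (+-assoc d m m)) (+-monoˡ-≤ (m + m) (≮⇒≥ v≮d)))

    expand-< : ∀ v → v < length (D ++ G) → expand v < length X
    expand-< v v< with v <? d
    ... | yes v<d rewrite <⇒<ᵇ≡true v<d = <-≤-trans v<d (subst (d ≤_) (sym (length-++ D)) (m≤m+n d _))
    ... | no v≮d rewrite ≥⇒<ᵇ≡false (≮⇒≥ v≮d) = subst (v + (m + m) <_) (sym length-X) (+-monoˡ-< (m + m) (subst (v <_) (length-++ D) v<))
      where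
        rearrange : ∀ d m g → d + g + (m + m) ≡ d + (m + (m + g))
        rearrange = solve-∀
        length-X : length X ≡ d + length G + (m + m)
        length-X = begin
          length X                                         ≡⟨ length-++ D ⟩
          d + length (A ++ ((A ᵇ⊥) ++ G))                  ≡⟨ cong (d +_) (length-++ A) ⟩
          d + (m + length ((A ᵇ⊥) ++ G))                   ≡⟨ cong (λ l → d + (m + l)) (length-++ (A ᵇ⊥)) ⟩
          d + (m + (length (A ᵇ⊥) + length G))             ≡⟨ cong (λ l → d + (m + (l + length G))) (length-ᵇ⊥ A) ⟩
          d + (m + (m + length G))                         ≡⟨ sym (rearrange d m (length G)) ⟩
          d + length G + (m + m)                           ∎
          where open ≡-Reasoning

    cut-valid : ∀ p q → IsMultiword (A ++ G) p → IsMultiword (D ++ (A ᵇ⊥)) q → IsMultiword (D ++ G) (cutRaw d m p q)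
    cut-valid p q P Q = record
      { directed = relabel-directed X (D ++ G) collapse traced (directed I) (λ x x∈ → at-collapse (glued-kept I x∈))
      ; perfect = λ v v< → begin
          occ v (endpoints (edges (relabel collapse traced))) ≡⟨ cong (occ v) (endpoints-relabel collapse traced) ⟩
          occ v (map collapse E)                              ≡⟨ occ-map collapse v (expand v) E (λ x x∈ → preimage x∈) ⟩
          occ (expand v) E                                    ≡⟨ outside-once I (expand v) (expand-< v v<) (expand-outside v) ⟩
          1                                                   ∎ }
      where
        open ≡-Reasoning
        traced = trace (map gluedPair (upTo m)) (tensorRaw d m m p q)
        I = glued-all (tensorRaw d m m p q) (glued-initial p q P Q)
        E = endpoints (edges traced)
        preimage : ∀ {x v} → x ∈ E → (collapse x ≡ v → x ≡ expand v) × (x ≡ expand v → collapse x ≡ v)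
        preimage {x} {v} x∈ = (λ e → trans (sym (expand-collapse (glued-kept I x∈))) (cong expand e))
                            , (λ e → trans (cong collapse e) (collapse-expand v))

  ⟦⟧ˢ-++ : ∀ Γ Δ → ⟦ Γ ++ Δ ⟧ˢ ≡ ⟦ Δ ⟧ˢ ++ ⟦ Γ ⟧ˢ
  ⟦⟧ˢ-++ [] Δ = sym (++-identityʳ _)
  ⟦⟧ˢ-++ (A ∷ Γ) Δ = trans (cong (_++ ⟦ A ⟧) (⟦⟧ˢ-++ Γ Δ)) (++-assoc ⟦ Δ ⟧ˢ ⟦ Γ ⟧ˢ ⟦ A ⟧)

  ⟦⟧ˢ-++-∷-∷ : ∀ Γ A B Δ → ⟦ Γ ++ A ∷ B ∷ Δ ⟧ˢ ≡ ⟦ Δ ⟧ˢ ++ (⟦ B ⟧ ++ (⟦ A ⟧ ++ ⟦ Γ ⟧ˢ))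
  ⟦⟧ˢ-++-∷-∷ Γ A B Δ = trans (⟦⟧ˢ-++ Γ (A ∷ B ∷ Δ))
    (trans (++-assoc (⟦ Δ ⟧ˢ ++ ⟦ B ⟧) ⟦ A ⟧ ⟦ Γ ⟧ˢ) (++-assoc ⟦ Δ ⟧ˢ ⟦ B ⟧ (⟦ A ⟧ ++ ⟦ Γ ⟧ˢ)))

  ⟦ᗮ⟧ : ∀ A → ⟦ A ᗮ ⟧ ≡ ⟦ A ⟧ ᵇ⊥
  ⟦ᗮ⟧ (pos p) = refl
  ⟦ᗮ⟧ (neg p) = sym (ᵇ⊥-involutive (bnd p))
  ⟦ᗮ⟧ (A ⊗ B) = trans (cong₂ _++_ (⟦ᗮ⟧ B) (⟦ᗮ⟧ A)) (sym (ᵇ⊥-++ ⟦ A ⟧ ⟦ B ⟧))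
  ⟦ᗮ⟧ (A ⅋ B) = trans (cong₂ _++_ (⟦ᗮ⟧ A) (⟦ᗮ⟧ B)) (sym (ᵇ⊥-++ ⟦ B ⟧ ⟦ A ⟧))

  premise-left-valid : ∀ Γ A {r} → IsMultiword ⟦ Γ ++ A ∷ [] ⟧ˢ r → IsMultiword (⟦ A ⟧ ++ ⟦ Γ ⟧ˢ) r
  premise-left-valid Γ A {r} = subst (λ X → IsMultiword X r) (⟦⟧ˢ-++ Γ (A ∷ []))

  premise-right-valid : ∀ A Δ {r} → IsMultiword ⟦ (A ᗮ) ∷ Δ ⟧ˢ r → IsMultiword (⟦ Δ ⟧ˢ ++ (⟦ A ⟧ ᵇ⊥)) r
  premise-right-valid A Δ {r} = subst (λ X → IsMultiword (⟦ Δ ⟧ˢ ++ X) r) (⟦ᗮ⟧ A)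

  interp-valid : ∀ {Ξ Θ} (d : Der Ξ Θ) → IsMultiword ⟦ Θ ⟧ˢ (interp d)
  interp-valid (axiom j _) = subst (λ X → IsMultiword X (Judgement.cow j)) (++-identityʳ _) (Judgement.valid j)
  interp-valid (identity A) =
    subst (λ X → IsMultiword (⟦ A ⟧ ++ X) (idRaw ⟦ A ⟧)) (sym (⟦ᗮ⟧ A)) (Identity.identity-valid ⟦ A ⟧)
  interp-valid (exchange Γ A B Δ p) = subst (λ X → IsMultiword X (interp (exchange Γ A B Δ p))) (sym (⟦⟧ˢ-++-∷-∷ Γ B A Δ))
    (swap-valid ⟦ Δ ⟧ˢ ⟦ B ⟧ ⟦ A ⟧ ⟦ Γ ⟧ˢ (interp p)
      (subst (λ X → IsMultiword X (interp p)) (⟦⟧ˢ-++-∷-∷ Γ A B Δ) (interp-valid p)))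
  interp-valid (par Γ A B p) = subst (λ X → IsMultiword X (interp p))
    (trans (⟦⟧ˢ-++ Γ (A ∷ B ∷ [])) (sym (⟦⟧ˢ-++ Γ ((A ⅋ B) ∷ [])))) (interp-valid p)
  interp-valid (tensor Γ A B Δ p q) = subst (λ X → IsMultiword X (interp (tensor Γ A B Δ p q))) (sym shape)
    (Tensor.tensor-valid ⟦ Δ ⟧ˢ ⟦ A ⟧ ⟦ B ⟧ ⟦ Γ ⟧ˢ (interp p) (interp q)
      (premise-left-valid Γ A (interp-valid p)) (interp-valid q))
    where
      shape : ⟦ Γ ++ (A ⊗ B) ∷ Δ ⟧ˢ ≡ ⟦ Δ ⟧ˢ ++ (⟦ A ⟧ ++ (⟦ B ⟧ ++ ⟦ Γ ⟧ˢ))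
      shape = trans (⟦⟧ˢ-++ Γ ((A ⊗ B) ∷ Δ))
        (trans (++-assoc ⟦ Δ ⟧ˢ (⟦ A ⟧ ++ ⟦ B ⟧) ⟦ Γ ⟧ˢ) (cong (⟦ Δ ⟧ˢ ++_) (++-assoc ⟦ A ⟧ ⟦ B ⟧ ⟦ Γ ⟧ˢ)))
  interp-valid (cut Γ A Δ p q) = subst (λ X → IsMultiword X (interp (cut Γ A Δ p q))) (sym (⟦⟧ˢ-++ Γ Δ))
    (Cut.cut-valid ⟦ Δ ⟧ˢ ⟦ A ⟧ ⟦ Γ ⟧ˢ (interp p) (interp q)
      (premise-left-valid Γ A (interp-valid p)) (premise-right-valid A Δ (interp-valid q)))

  -- Invariance under reordering, and the identity law for cut

  infix 4 _↭ᵐ_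
  _↭ᵐ_ : RawMW → RawMW → Set
  r ↭ᵐ s = (edges r ↭ edges s) × (cycles r ↭ cycles s)

  ↭ᵐ-refl : ∀ {r} → r ↭ᵐ r
  ↭ᵐ-refl = refl , refl

  ↭ᵐ-reflexive : ∀ {r s} → r ≡ s → r ↭ᵐ s
  ↭ᵐ-reflexive refl = ↭ᵐ-refl

  ↭ᵐ-sym : ∀ {r s} → r ↭ᵐ s → s ↭ᵐ r
  ↭ᵐ-sym (es , cs) = ↭-sym es , ↭-sym cs

  ↭ᵐ-trans : ∀ {r s u} → r ↭ᵐ s → s ↭ᵐ u → r ↭ᵐ u
  ↭ᵐ-trans (es , cs) (es′ , cs′) = ↭-trans es es′ , ↭-trans cs cs′

  relabel-↭ᵐ : ∀ f {r s} → r ↭ᵐ s → relabel f r ↭ᵐ relabel f s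
  relabel-↭ᵐ f (es , cs) = map⁺ (relabelEdge f) es , cs

  relabel-∘ : ∀ f g r → relabel f (relabel g r) ≡ relabel (λ x → f (g x)) r
  relabel-∘ f g r = cong (λ es → mw es (cycles r)) (sym (map-∘ (edges r)))

  map-relabelEdge-cong : ∀ f g es → (∀ x → x ∈ endpoints es → f x ≡ g x) → map (relabelEdge f) es ≡ map (relabelEdge g) es
  map-relabelEdge-cong f g [] _ = refl
  map-relabelEdge-cong f g ((i , w , j) ∷ es) h =
    cong₂ _∷_ (cong₂ (λ x y → x , w , y) (h i (here refl)) (h j (there (here refl))))
              (map-relabelEdge-cong f g es (λ x x∈ → h x (there (there x∈))))

  relabel-cong : ∀ f g r → (∀ x → f x ≡ g x) → relabel f r ≡ relabel g r
  relabel-cong f g r h = cong (λ es → mw es (cycles r)) (map-relabelEdge-cong f g (edges r) (λ x _ → h x))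

  map-relabelEdge-id : ∀ f es → (∀ x → f x ≡ x) → map (relabelEdge f) es ≡ es
  map-relabelEdge-id f es h = trans (map-cong (λ (i , w , j) → cong₂ (λ x y → x , w , y) (h i) (h j)) es) (map-id es)

  relabel-id : ∀ f r → (∀ x → f x ≡ x) → relabel f r ≡ r
  relabel-id f r h = cong (λ es → mw es (cycles r)) (map-relabelEdge-id f (edges r) h)

  union-↭ᵐ : ∀ {r r′ s s′} → r ↭ᵐ r′ → s ↭ᵐ s′ → union r s ↭ᵐ union r′ s′
  union-↭ᵐ (es , cs) (fs , ds) = ++⁺-↭ es fs , ++⁺-↭ cs ds

  ↭ᵐ⇒≈ : ∀ {r s u} → r ↭ᵐ s → s ≈ u → r ≈ u
  ↭ᵐ⇒≈ (es , cs) (es′ , (ds , rot , ds↭)) with ↭-Pointwise⇒Pointwise-↭ cs rot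
  ... | ws , rot′ , ws↭ = ↭-trans es es′ , (ws , rot′ , ↭-trans ws↭ ds↭)

  two-edges-↭⇒degree≢1 : ∀ w {es e e′ R} → es ↭ e ∷ e′ ∷ R → hasEnd w e ≡ true → hasEnd w e′ ≡ true →
    degree w es ≢ 1
  two-edges-↭⇒degree≢1 w {e = e} {e′} {R} p h h′ d =
    two-edges⇒degree≢1 w e (e′ ∷ R) h h′ (here refl) (trans (sym (degree-↭ w p)) d)

  module GlueCongruence (X : Boundary) {u v : ℕ} {es es′ : List Edge} {cs cs′ : List Word}
           (D : Directed X es) (du : degree u es ≡ 1) (dv : degree v es ≡ 1)
           (es↭ : es ↭ es′) (cs↭ : cs ↭ cs′) where
    private
      D′ : Directed X es′
      D′ = All-resp-↭ es↭ D

      du′ : degree u es′ ≡ 1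
      du′ = trans (sym (degree-↭ u es↭)) du

      dv′ : degree v es′ ≡ 1
      dv′ = trans (sym (degree-↭ v es↭)) dv

      same-edge : ∀ w {e e′} → degree w es ≡ 1 → e ∈ es → e′ ∈ es′ → hasEnd w e ≡ true → hasEnd w e′ ≡ true → e ≡ e′
      same-edge w d e∈ e′∈ h h′ = edge-at-unique w e∈ (∈-↭⁻ es↭ e′∈) h h′ d

      rests-↭ : ∀ {e R R′} → es ↭ e ∷ R → es′ ↭ e ∷ R′ → R ↭ R′
      rests-↭ p p′ = drop-∷ (↭-trans (↭-sym p) (↭-trans es↭ p′))

    glue1-↭ᵐ-atRightEnd : at X u ≡ just false → at X v ≡ just true → glue1 u v (mw es cs) ↭ᵐ glue1 u v (mw es′ cs′)
    glue1-↭ᵐ-atRightEnd pu pv with glue1-atRightEnd X u v es cs D du dv pu pv | glue1-atRightEnd X u v es′ cs′ D′ du′ dv′ pu pv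
    ... | cycle w R p e | cycle w′ R′ p′ e′ rewrite e | e′
        with same-edge u du (∈-↭⁻ p (here refl)) (∈-↭⁻ p′ (here refl)) (hasEnd-end u v w) (hasEnd-end u v w′)
    ... | refl = rests-↭ p p′ , prep w cs↭
    glue1-↭ᵐ-atRightEnd pu pv | cycle w R p e | path i w₁ w₂ j R′ p′ e′
        with same-edge u du (∈-↭⁻ p (here refl)) (∈-↭⁻ p′ (here refl)) (hasEnd-end u v w) (hasEnd-end u i w₁)
    ... | refl = ⊥-elim (two-edges-↭⇒degree≢1 v p′ (hasEnd-start v w₁ u) (hasEnd-start v w₂ j) dv′)
    glue1-↭ᵐ-atRightEnd pu pv | path i w₁ w₂ j R p e | cycle w′ R′ p′ e′
        with same-edge u du (∈-↭⁻ p (here refl)) (∈-↭⁻ p′ (here refl)) (hasEnd-end u i w₁) (hasEnd-end u v w′)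
    ... | refl = ⊥-elim (two-edges-↭⇒degree≢1 v p (hasEnd-start v w₁ u) (hasEnd-start v w₂ j) dv)
    glue1-↭ᵐ-atRightEnd pu pv | path i w₁ w₂ j R p e | path i′ w₁′ w₂′ j′ R′ p′ e′ rewrite e | e′
        with same-edge u du (∈-↭⁻ p (here refl)) (∈-↭⁻ p′ (here refl)) (hasEnd-end u i w₁) (hasEnd-end u i′ w₁′)
           | same-edge v dv (∈-↭⁻ p (there (here refl))) (∈-↭⁻ p′ (there (here refl))) (hasEnd-start v w₂ j) (hasEnd-start v w₂′ j′)
    ... | refl | refl = prep _ (drop-∷ (rests-↭ p p′)) , cs↭

    glue1-↭ᵐ-atLeftEnd : at X u ≡ just true → at X v ≡ just false → glue1 u v (mw es cs) ↭ᵐ glue1 u v (mw es′ cs′)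
    glue1-↭ᵐ-atLeftEnd pu pv with glue1-atLeftEnd X u v es cs D du dv pu pv | glue1-atLeftEnd X u v es′ cs′ D′ du′ dv′ pu pv
    ... | cycle w R p e | cycle w′ R′ p′ e′ rewrite e | e′
        with same-edge u du (∈-↭⁻ p (here refl)) (∈-↭⁻ p′ (here refl)) (hasEnd-start u w v) (hasEnd-start u w′ v)
    ... | refl = rests-↭ p p′ , prep w cs↭
    glue1-↭ᵐ-atLeftEnd pu pv | cycle w R p e | path j w₁ i w₂ R′ p′ e′
        with same-edge u du (∈-↭⁻ p (here refl)) (∈-↭⁻ p′ (here refl)) (hasEnd-start u w v) (hasEnd-start u w₁ j)
    ... | refl = ⊥-elim (two-edges-↭⇒degree≢1 v p′ (hasEnd-end v u w₁) (hasEnd-end v i w₂) dv′)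
    glue1-↭ᵐ-atLeftEnd pu pv | path j w₁ i w₂ R p e | cycle w′ R′ p′ e′
        with same-edge u du (∈-↭⁻ p (here refl)) (∈-↭⁻ p′ (here refl)) (hasEnd-start u w₁ j) (hasEnd-start u w′ v)
    ... | refl = ⊥-elim (two-edges-↭⇒degree≢1 v p (hasEnd-end v u w₁) (hasEnd-end v i w₂) dv)
    glue1-↭ᵐ-atLeftEnd pu pv | path j w₁ i w₂ R p e | path j′ w₁′ i′ w₂′ R′ p′ e′ rewrite e | e′
        with same-edge u du (∈-↭⁻ p (here refl)) (∈-↭⁻ p′ (here refl)) (hasEnd-start u w₁ j) (hasEnd-start u w₁′ j′)
           | same-edge v dv (∈-↭⁻ p (there (here refl))) (∈-↭⁻ p′ (there (here refl))) (hasEnd-end v i w₂) (hasEnd-end v i′ w₂′)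
    ... | refl | refl = prep _ (drop-∷ (rests-↭ p p′)) , cs↭

    glue1-↭ᵐ : ∀ b → at X u ≡ just b → at X v ≡ just (not b) → glue1 u v (mw es cs) ↭ᵐ glue1 u v (mw es′ cs′)
    glue1-↭ᵐ false = glue1-↭ᵐ-atRightEnd
    glue1-↭ᵐ true = glue1-↭ᵐ-atLeftEnd

  module CutCongruence (D A G : Boundary) where
    open Cut D A G

    glue-step-↭ᵐ : ∀ {j r s} → j < m → GluedUpTo j (edges r) → r ↭ᵐ s →
      glue1 (lo (suc j)) (hi j) r ↭ᵐ glue1 (lo (suc j)) (hi j) s
    glue-step-↭ᵐ j<m I (es↭ , cs↭) with glued-polarity j<m
    ... | b , pu , pv =
      GlueCongruence.glue1-↭ᵐ X (directed I) (glued-degree-lo j<m I) (glued-degree-hi j<m I) es↭ cs↭ b pu pv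

    trace-↭ᵐ : ∀ n j r s → j + n ≤ m → GluedUpTo j (edges r) → r ↭ᵐ s →
      trace (map gluedPair (range j n)) r ↭ᵐ trace (map gluedPair (range j n)) s
    trace-↭ᵐ zero j r s _ _ r↭s = r↭s
    trace-↭ᵐ (suc n) j r s j+n≤m I r↭s =
      trace-↭ᵐ n (suc j) (glue1 (lo (suc j)) (hi j) r) (glue1 (lo (suc j)) (hi j) s) (subst (_≤ m) (+-suc j n) j+n≤m)
        (glued-step (edges r) (cycles r) j<m I) (glue-step-↭ᵐ j<m I r↭s)
      where
        j<m : j < m
        j<m = <-≤-trans (m<m+n j z<s) j+n≤m

    cut-↭ᵐ : ∀ p q p′ q′ → IsMultiword (A ++ G) p → IsMultiword (D ++ (A ᵇ⊥)) q → p ↭ᵐ p′ → q ↭ᵐ q′ →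
      cutRaw d m p q ↭ᵐ cutRaw d m p′ q′
    cut-↭ᵐ p q p′ q′ P Q p↭ q↭ = relabel-↭ᵐ collapse traced
      where
        traced : trace (map gluedPair (upTo m)) (tensorRaw d m m p q) ↭ᵐ trace (map gluedPair (upTo m)) (tensorRaw d m m p′ q′)
        traced rewrite upTo≡range m =
          trace-↭ᵐ m 0 _ _ ≤-refl (glued-initial p q P Q) (union-↭ᵐ (relabel-↭ᵐ _ p↭) (relabel-↭ᵐ _ q↭))

  glue1-reroute-atRightEnd : ∀ X u v es cs {i w x R} → Directed X es → degree u es ≡ 1 → degree v es ≡ 1 →
    at X u ≡ just false → at X v ≡ just true → x ≢ u → es ↭ (i , w , u) ∷ (v , [] , x) ∷ R →
    (edges (glue1 u v (mw es cs)) ↭ (i , w , x) ∷ R) × (cycles (glue1 u v (mw es cs)) ≡ cs)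
  glue1-reroute-atRightEnd X u v es cs {i} {w} {x} D du dv pu pv x≢u es↭ with glue1-atRightEnd X u v es cs D du dv pu pv
  ... | cycle w′ R′ p e = ⊥-elim (x≢u (sym (cong (λ e → proj₂ (proj₂ e)) at-v)))
    where
      at-v = edge-at-unique v (∈-↭⁻ p (here refl)) (∈-↭⁻ es↭ (there (here refl))) (hasEnd-start v w′ u) (hasEnd-start v [] x) dv
  ... | path i′ w₁ w₂ j R′ p e rewrite e
      with edge-at-unique u (∈-↭⁻ p (here refl)) (∈-↭⁻ es↭ (here refl)) (hasEnd-end u i′ w₁) (hasEnd-end u i w) du
         | edge-at-unique v (∈-↭⁻ p (there (here refl))) (∈-↭⁻ es↭ (there (here refl))) (hasEnd-start v w₂ j) (hasEnd-start v [] x) dv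
  ... | refl | refl = ↭-trans (↭-reflexive (cong (λ w′ → (i , w′ , x) ∷ R′) (++-identityʳ w)))
                               (prep _ (drop-∷ (drop-∷ (↭-trans (↭-sym p) es↭)))) , refl

  glue1-reroute-atLeftEnd : ∀ X u v es cs {w j x R} → Directed X es → degree u es ≡ 1 → degree v es ≡ 1 →
    at X u ≡ just true → at X v ≡ just false → x ≢ u → es ↭ (u , w , j) ∷ (x , [] , v) ∷ R →
    (edges (glue1 u v (mw es cs)) ↭ (x , w , j) ∷ R) × (cycles (glue1 u v (mw es cs)) ≡ cs)
  glue1-reroute-atLeftEnd X u v es cs {w} {j} {x} D du dv pu pv x≢u es↭ with glue1-atLeftEnd X u v es cs D du dv pu pv
  ... | cycle w′ R′ p e = ⊥-elim (x≢u (sym (cong proj₁ at-v)))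
    where
      at-v = edge-at-unique v (∈-↭⁻ p (here refl)) (∈-↭⁻ es↭ (there (here refl))) (hasEnd-end v u w′) (hasEnd-end v x []) dv
  ... | path j′ w₁ i w₂ R′ p e rewrite e
      with edge-at-unique u (∈-↭⁻ p (here refl)) (∈-↭⁻ es↭ (here refl)) (hasEnd-start u w₁ j′) (hasEnd-start u w j) du
         | edge-at-unique v (∈-↭⁻ p (there (here refl))) (∈-↭⁻ es↭ (there (here refl))) (hasEnd-end v i w₂) (hasEnd-end v x []) dv
  ... | refl | refl = prep _ (drop-∷ (drop-∷ (↭-trans (↭-sym p) es↭))) , refl

  idEdges-++ : ∀ n i xs ys → idEdges n i (xs ++ ys) ≡ idEdges n i xs ++ idEdges n (i + length xs) ys
  idEdges-++ n i [] ys = cong (λ j → idEdges n j ys) (sym (+-identityʳ i))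
  idEdges-++ n i (x ∷ xs) ys = cong (_ ∷_)
    (trans (idEdges-++ n (suc i) xs ys) (cong (λ j → idEdges n (suc i) xs ++ idEdges n j ys) (sym (+-suc i _))))

  module IdentityLaw (A G : Boundary) (p : RawMW) (p-valid : IsMultiword (A ++ G) p) where
    open Cut A A G

    fq : ℕ → ℕ
    fq v = if v <ᵇ m then v else v + m

    -- Where vertex x of p sits after j gluing steps: a vertex x < m of the cut formula starts in
    -- the [A] block at x + m and moves to x once it has been glued to the identity edge at x.
    position : ℕ → ℕ → ℕ
    position j x = if x <ᵇ m then (if x <ᵇ m ∸ j then x + m else x) else x + m + m

    pending : ℕ → List Edge
    pending j = map (relabelEdge fq) (idEdges m 0 (take (m ∸ j) A))

    record Invariant (j : ℕ) (r : RawMW) : Set where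
      field
        glued        : GluedUpTo j (edges r)
        edges-shape  : edges r ↭ map (relabelEdge (position j)) (edges p) ++ pending j
        cycles-shape : cycles r ≡ cycles p ++ []
    open Invariant

    invariant-initial : Invariant 0 (tensorRaw m m m p (idRaw A))
    invariant-initial = record
      { glued = glued-initial p (idRaw A) p-valid (Identity.identity-valid A)
      ; edges-shape = ↭-reflexive (cong₂ _++_
          (map-relabelEdge-cong _ (position 0) (edges p) (λ x _ → tensor-position x))
          (cong (λ X → map (relabelEdge fq) (idEdges m 0 X)) (sym (take-all m A ≤-refl))))
      ; cycles-shape = refl }
      where
        tensor-position : ∀ x → (if x <ᵇ m then x + m else x + m + m) ≡ position 0 x
        tensor-position x with x <ᵇ m
        ... | true = refl
        ... | false = refl

    collapse-position : ∀ x → collapse (position m x) ≡ x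
    collapse-position x with x <? m
    ... | yes x<m rewrite <⇒<ᵇ≡true x<m | n∸n≡0 m | <⇒<ᵇ≡true x<m = refl
    ... | no x≮m rewrite ≥⇒<ᵇ≡false (≮⇒≥ x≮m) | ≥⇒<ᵇ≡false (≤-trans (m≤n+m m x) (m≤m+n (x + m) m)) =
      trans (cong (_∸ (m + m)) (+-assoc x m m)) (m+n∸n≡m x (m + m))

    module Step {j : ℕ} (j<m : j < m) where
      x₀ = m ∸ suc j
      u = lo (suc j)
      v = hi j

      x₀<m : x₀ < m
      x₀<m = m∸suc[n]<m j<m

      m∸j≡suc[x₀] : m ∸ j ≡ suc x₀
      m∸j≡suc[x₀] = m∸n≡suc[m∸suc[n]] j<m

      x₀≢u : x₀ ≢ u
      x₀≢u = <⇒≢ (m<n+m x₀ (≤-<-trans z≤n j<m))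

      position-before : position j x₀ ≡ u
      position-before rewrite <⇒<ᵇ≡true x₀<m | <⇒<ᵇ≡true (subst (x₀ <_) (sym m∸j≡suc[x₀]) (n<1+n x₀)) = +-comm x₀ m

      position-after : position (suc j) x₀ ≡ x₀
      position-after rewrite <⇒<ᵇ≡true x₀<m | ≥⇒<ᵇ≡false (≤-refl {x₀}) = refl

      position-other : ∀ {y} → y ≢ x₀ → position (suc j) y ≡ position j y
      position-other {y} y≢x₀ with y <? m
      ... | no y≮m rewrite ≥⇒<ᵇ≡false (≮⇒≥ y≮m) = refl
      ... | yes y<m rewrite <⇒<ᵇ≡true y<m with y <? x₀
      ...   | yes y<x₀ rewrite <⇒<ᵇ≡true y<x₀ | <⇒<ᵇ≡true (subst (y <_) (sym m∸j≡suc[x₀]) (<-trans y<x₀ (n<1+n x₀))) = refl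
      ...   | no y≮x₀ rewrite ≥⇒<ᵇ≡false (≮⇒≥ y≮x₀)
                            | ≥⇒<ᵇ≡false (subst (_≤ y) (sym m∸j≡suc[x₀]) (≤∧≢⇒< (≮⇒≥ y≮x₀) (≢-sym y≢x₀))) = refl

      fq-x₀ : fq x₀ ≡ x₀
      fq-x₀ rewrite <⇒<ᵇ≡true x₀<m = refl

      mirror≡m+j : (m + m) ∸ suc x₀ ≡ m + j
      mirror≡m+j = trans (cong ((m + m) ∸_) (sym m∸j≡suc[x₀]))
                         (trans (+-∸-assoc m (m∸n≤m m j)) (cong (m +_) (m∸[m∸n]≡n (<⇒≤ j<m))))

      fq-mirror : fq ((m + m) ∸ suc x₀) ≡ v
      fq-mirror rewrite mirror≡m+j | ≥⇒<ᵇ≡false (m≤m+n m j) = rearrange m j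
        where
          rearrange : ∀ m j → m + j + m ≡ m + m + j
          rearrange = solve-∀

      snoc = take-suc A x₀ x₀<m
      b = proj₁ snoc

      idEdge : Bool → Edge
      idEdge b = if b then (x₀ , [] , v) else (v , [] , x₀)

      pending-split : pending j ≡ pending (suc j) ++ idEdge b ∷ []
      pending-split = begin
        pending j
          ≡⟨ cong (λ n → map (relabelEdge fq) (idEdges m 0 (take n A))) m∸j≡suc[x₀] ⟩
        map (relabelEdge fq) (idEdges m 0 (take (suc x₀) A))
          ≡⟨ cong (λ X → map (relabelEdge fq) (idEdges m 0 X)) (proj₁ (proj₂ snoc)) ⟩
        map (relabelEdge fq) (idEdges m 0 (take x₀ A ++ b ∷ []))
          ≡⟨ cong (map (relabelEdge fq)) (idEdges-++ m 0 (take x₀ A) (b ∷ [])) ⟩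
        map (relabelEdge fq) (idEdges m 0 (take x₀ A) ++ idEdges m (length (take x₀ A)) (b ∷ []))
          ≡⟨ map-++ (relabelEdge fq) (idEdges m 0 (take x₀ A)) _ ⟩
        pending (suc j) ++ map (relabelEdge fq) (idEdges m (length (take x₀ A)) (b ∷ []))
          ≡⟨ cong (λ i → pending (suc j) ++ map (relabelEdge fq) (idEdges m i (b ∷ []))) length-take-x₀ ⟩
        pending (suc j) ++ map (relabelEdge fq) (idEdges m x₀ (b ∷ []))
          ≡⟨ cong (λ e → pending (suc j) ++ e ∷ []) (identity-edge b) ⟩
        pending (suc j) ++ idEdge b ∷ []
          ∎
        where
          open ≡-Reasoning
          length-take-x₀ : length (take x₀ A) ≡ x₀
          length-take-x₀ = trans (length-take x₀ A) (m≤n⇒m⊓n≡m (<⇒≤ x₀<m))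
          identity-edge : ∀ b → relabelEdge fq (if b then (x₀ , [] , (m + m) ∸ suc x₀) else ((m + m) ∸ suc x₀ , [] , x₀)) ≡ idEdge b
          identity-edge true = cong₂ (λ x y → x , [] , y) fq-x₀ fq-mirror
          identity-edge false = cong₂ (λ x y → x , [] , y) fq-mirror fq-x₀

      pu : at X u ≡ just b
      pu = trans (at-lo j<m) (proj₂ (proj₂ snoc))

      pv : at X v ≡ just (not b)
      pv = trans (at-hi j<m) (cong (Maybe.map not) (proj₂ (proj₂ snoc)))

      module _ {r : RawMW} (inv : Invariant j r) where
        private
          D = directed (glued inv)
          du = glued-degree-lo j<m (glued inv)
          dv = glued-degree-hi j<m (glued inv)

          degree-x₀ : degree x₀ (edges p) ≡ 1
          degree-x₀ = IsMultiword.perfect p-valid x₀ (subst (x₀ <_) (sym (length-++ A)) (<-≤-trans x₀<m (m≤m+n m _)))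

          found = degree≥1⇒∈ x₀ (edges p) (≤-reflexive (sym degree-x₀))
          split = ∈-∃++ (proj₁ (proj₂ found))

        e₀ : Edge
        e₀ = proj₁ found

        a₀ c₀ : ℕ
        a₀ = proj₁ e₀
        c₀ = proj₂ (proj₂ e₀)

        w₀ : Word
        w₀ = proj₁ (proj₂ e₀)

        others : List Edge
        others = proj₁ split ++ proj₁ (proj₂ split)

        edges-p↭ : edges p ↭ e₀ ∷ others
        edges-p↭ = ↭-trans (↭-reflexive (proj₂ (proj₂ split))) (shift e₀ (proj₁ split) (proj₁ (proj₂ split)))

        x₀∉others : ∀ y → y ∈ endpoints others → y ≢ x₀
        x₀∉others y y∈ refl = occ≡0⇒∉ (n≤0⇒n≡0 (s≤s⁻¹ (begin
          1 + degree x₀ others                  ≤⟨ +-monoˡ-≤ _ (hasEnd⇒occ≥1 x₀ e₀ (proj₂ (proj₂ found))) ⟩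
          occ x₀ (edgeEnds e₀) + degree x₀ others ≡⟨ sym (degree-∷ x₀ e₀ others) ⟩
          degree x₀ (e₀ ∷ others)               ≡⟨ sym (degree-↭ x₀ edges-p↭) ⟩
          degree x₀ (edges p)                   ≡⟨ degree-x₀ ⟩
          1                                     ∎))) y∈
          where open ≤-Reasoning

        rest : List Edge
        rest = map (relabelEdge (position j)) others ++ pending (suc j)

        canonical : edges r ↭ relabelEdge (position j) e₀ ∷ idEdge b ∷ rest
        canonical = ↭-trans (edges-shape inv)
          (↭-trans (++⁺-↭ (map⁺ (relabelEdge (position j)) edges-p↭) (↭-reflexive pending-split))
                   (prep _ (↭-trans (↭-reflexive (sym (++-assoc (map (relabelEdge (position j)) others) (pending (suc j)) _)))
                                    (↭-sym (∷↭∷ʳ (idEdge b) rest)))))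

        target : map (relabelEdge (position (suc j))) (edges p) ++ pending (suc j) ↭ relabelEdge (position (suc j)) e₀ ∷ rest
        target = ↭-trans (++⁺ʳ-↭ (pending (suc j)) (map⁺ (relabelEdge (position (suc j))) edges-p↭))
          (↭-reflexive (cong (λ es → relabelEdge (position (suc j)) e₀ ∷ es ++ pending (suc j))
            (map-relabelEdge-cong _ _ others (λ y y∈ → position-other (x₀∉others y y∈)))))

        e₀-directed : EdgeOK X (relabelEdge (position j) e₀)
        e₀-directed = All.lookup D (∈-↭⁻ canonical (here refl))

        GlueResult : Set
        GlueResult = (edges (glue1 u v r) ↭ relabelEdge (position (suc j)) e₀ ∷ rest) × (cycles (glue1 u v r) ≡ cycles r)

        glued-atRightEnd : b ≡ false → GlueResult
        glued-atRightEnd b≡ =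
          ↭-trans (proj₁ rerouted) (↭-reflexive (cong (_∷ rest) (sym new-edge))) , proj₂ rerouted
          where
            pu′ = subst (λ b → at X u ≡ just b) b≡ pu
            a₀≢x₀ : a₀ ≢ x₀
            a₀≢x₀ a₀≡x₀ = polarities-differ⇒≢ X (proj₁ e₀-directed) pu′ (λ ()) (trans (cong (position j) a₀≡x₀) position-before)
            c₀≡x₀ : c₀ ≡ x₀
            c₀≡x₀ with hasEnd⇒endpoint x₀ a₀ w₀ c₀ (proj₂ (proj₂ found))
            ... | inj₁ x₀≡a₀ = ⊥-elim (a₀≢x₀ (sym x₀≡a₀))
            ... | inj₂ x₀≡c₀ = sym x₀≡c₀
            rerouted = glue1-reroute-atRightEnd X u v (edges r) (cycles r) D du dv pu′
              (subst (λ b → at X v ≡ just (not b)) b≡ pv) x₀≢u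
              (subst (λ c → edges r ↭ (position j a₀ , w₀ , c) ∷ (v , [] , x₀) ∷ rest)
                     (trans (cong (position j) c₀≡x₀) position-before)
                     (subst (λ b → edges r ↭ relabelEdge (position j) e₀ ∷ idEdge b ∷ rest) b≡ canonical))
            new-edge : relabelEdge (position (suc j)) e₀ ≡ (position j a₀ , w₀ , x₀)
            new-edge = cong₂ (λ x y → x , w₀ , y) (position-other a₀≢x₀) (trans (cong (position (suc j)) c₀≡x₀) position-after)

        glued-atLeftEnd : b ≡ true → GlueResult
        glued-atLeftEnd b≡ =
          ↭-trans (proj₁ rerouted) (↭-reflexive (cong (_∷ rest) (sym new-edge))) , proj₂ rerouted
          where
            pu′ = subst (λ b → at X u ≡ just b) b≡ pu
            c₀≢x₀ : c₀ ≢ x₀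
            c₀≢x₀ c₀≡x₀ = polarities-differ⇒≢ X (proj₂ e₀-directed) pu′ (λ ()) (trans (cong (position j) c₀≡x₀) position-before)
            a₀≡x₀ : a₀ ≡ x₀
            a₀≡x₀ with hasEnd⇒endpoint x₀ a₀ w₀ c₀ (proj₂ (proj₂ found))
            ... | inj₁ x₀≡a₀ = sym x₀≡a₀
            ... | inj₂ x₀≡c₀ = ⊥-elim (c₀≢x₀ (sym x₀≡c₀))
            rerouted = glue1-reroute-atLeftEnd X u v (edges r) (cycles r) D du dv pu′
              (subst (λ b → at X v ≡ just (not b)) b≡ pv) x₀≢u
              (subst (λ a → edges r ↭ (a , w₀ , position j c₀) ∷ (x₀ , [] , v) ∷ rest)
                     (trans (cong (position j) a₀≡x₀) position-before)
                     (subst (λ b → edges r ↭ relabelEdge (position j) e₀ ∷ idEdge b ∷ rest) b≡ canonical))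
            new-edge : relabelEdge (position (suc j)) e₀ ≡ (x₀ , w₀ , position j c₀)
            new-edge = cong₂ (λ x y → x , w₀ , y) (trans (cong (position (suc j)) a₀≡x₀) position-after) (position-other c₀≢x₀)

        glue-result : GlueResult
        glue-result with b in b≡
        ... | false = glued-atRightEnd b≡
        ... | true = glued-atLeftEnd b≡

        step : Invariant (suc j) (glue1 u v r)
        step = record
          { glued = glued-step (edges r) (cycles r) j<m (glued inv)
          ; edges-shape = ↭-trans (proj₁ glue-result) (↭-sym target)
          ; cycles-shape = trans (proj₂ glue-result) (cycles-shape inv) }

    invariant-range : ∀ n j r → j + n ≤ m → Invariant j r → Invariant (j + n) (trace (map gluedPair (range j n)) r)
    invariant-range zero j r _ inv = subst (λ i → Invariant i r) (sym (+-identityʳ j)) inv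
    invariant-range (suc n) j r j+n≤m inv =
      subst (λ i → Invariant i (trace (map gluedPair (range (suc j) n)) r′)) (sym (+-suc j n))
        (invariant-range n (suc j) r′ (subst (_≤ m) (+-suc j n) j+n≤m) (Step.step j<m inv))
      where
        j<m : j < m
        j<m = <-≤-trans (m<m+n j z<s) j+n≤m
        r′ = glue1 (lo (suc j)) (hi j) r

    identity-law : cutRaw m m p (idRaw A) ↭ᵐ p
    identity-law = edges↭ , ↭-reflexive (trans (cycles-shape final) (++-identityʳ (cycles p)))
      where
        traced = trace (map gluedPair (upTo m)) (tensorRaw m m m p (idRaw A))
        final : Invariant m traced
        final rewrite upTo≡range m = invariant-range m 0 _ ≤-refl invariant-initial
        pending-m : pending m ≡ []
        pending-m rewrite n∸n≡0 m = refl
        edges↭ : map (relabelEdge collapse) (edges traced) ↭ edges p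
        edges↭ = ↭-trans (map⁺ (relabelEdge collapse) (edges-shape final)) (↭-reflexive (begin
          map (relabelEdge collapse) (map (relabelEdge (position m)) (edges p) ++ pending m)
            ≡⟨ map-++ (relabelEdge collapse) _ (pending m) ⟩
          map (relabelEdge collapse) (map (relabelEdge (position m)) (edges p)) ++ map (relabelEdge collapse) (pending m)
            ≡⟨ cong₂ _++_ (sym (map-∘ (edges p))) (cong (map (relabelEdge collapse)) pending-m) ⟩
          map (relabelEdge (λ x → collapse (position m x))) (edges p) ++ []
            ≡⟨ trans (++-identityʳ _) (map-relabelEdge-id _ (edges p) collapse-position) ⟩
          edges p ∎))
          where open ≡-Reasoning

  -- Moving blocks of formulas by exchanges, and the η-expansion of ⅋

  swapBlocks-nothing-passed : ∀ e c v → swapBlocks e 0 c v ≡ v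
  swapBlocks-nothing-passed e c v with blocks e 0 c v
  ... | front v<e = swapBlocks-front e 0 c v<e
  ... | second {r} r<c = trans (swapBlocks-second e 0 c r<c) (cong (_+ r) (sym (+-identityʳ e)))
  ... | back r = swapBlocks-back e 0 c r

  swapBlocks-nothing-moved : ∀ e δ v → swapBlocks e δ 0 v ≡ v
  swapBlocks-nothing-moved e δ v with blocks e δ 0 v
  ... | front v<e = swapBlocks-front e δ 0 v<e
  ... | first {r} r<δ = trans (swapBlocks-first e δ 0 r<δ) (cong (_+ r) (+-identityʳ e))
  ... | back r = swapBlocks-back e δ 0 r

  swapBlocks-concat-passed : ∀ e δ x c v → swapBlocks e δ c (swapBlocks (e + δ) x c v) ≡ swapBlocks e (δ + x) c v
  swapBlocks-concat-passed e δ x c v with blocks (e + δ) x c v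
  ... | front v<e+δ rewrite swapBlocks-front (e + δ) x c v<e+δ with blocks e δ c v
  ...   | front v<e = trans (swapBlocks-front e δ c v<e) (sym (swapBlocks-front e (δ + x) c v<e))
  ...   | first r<δ = trans (swapBlocks-first e δ c r<δ) (sym (swapBlocks-first e (δ + x) c (<-≤-trans r<δ (m≤m+n δ x))))
  ...   | second {r} _ = ⊥-elim (<⇒≱ v<e+δ (m≤m+n (e + δ) r))
  ...   | back r = ⊥-elim (<⇒≱ v<e+δ (≤-trans (m≤m+n (e + δ) c) (m≤m+n (e + δ + c) r)))
  swapBlocks-concat-passed e δ x c v | first {r} r<x = begin
    swapBlocks e δ c (swapBlocks (e + δ) x c (e + δ + r)) ≡⟨ cong (swapBlocks e δ c) (swapBlocks-first (e + δ) x c r<x) ⟩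
    swapBlocks e δ c (e + δ + c + r)                       ≡⟨ swapBlocks-back e δ c r ⟩
    e + δ + c + r                                          ≡⟨ rearrange e δ c r ⟩
    e + c + (δ + r)                                        ≡⟨ sym (swapBlocks-first e (δ + x) c (+-monoʳ-< δ r<x)) ⟩
    swapBlocks e (δ + x) c (e + (δ + r))                   ≡⟨ cong (swapBlocks e (δ + x) c) (sym (+-assoc e δ r)) ⟩
    swapBlocks e (δ + x) c (e + δ + r)                     ∎
    where
      open ≡-Reasoning
      rearrange : ∀ e δ c r → e + δ + c + r ≡ e + c + (δ + r)
      rearrange = solve-∀
  swapBlocks-concat-passed e δ x c v | second {r} r<c = begin
    swapBlocks e δ c (swapBlocks (e + δ) x c (e + δ + x + r)) ≡⟨ cong (swapBlocks e δ c) (swapBlocks-second (e + δ) x c r<c) ⟩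
    swapBlocks e δ c (e + δ + r)                               ≡⟨ swapBlocks-second e δ c r<c ⟩
    e + r                                                      ≡⟨ sym (swapBlocks-second e (δ + x) c r<c) ⟩
    swapBlocks e (δ + x) c (e + (δ + x) + r)                   ≡⟨ cong (λ y → swapBlocks e (δ + x) c (y + r)) (sym (+-assoc e δ x)) ⟩
    swapBlocks e (δ + x) c (e + δ + x + r)                     ∎
    where open ≡-Reasoning
  swapBlocks-concat-passed e δ x c v | back r = begin
    swapBlocks e δ c (swapBlocks (e + δ) x c (e + δ + x + c + r)) ≡⟨ cong (swapBlocks e δ c) (swapBlocks-back (e + δ) x c r) ⟩
    swapBlocks e δ c (e + δ + x + c + r)                          ≡⟨ cong (swapBlocks e δ c) (rearrange e δ x c r) ⟩
    swapBlocks e δ c (e + δ + c + (x + r))                        ≡⟨ swapBlocks-back e δ c (x + r) ⟩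
    e + δ + c + (x + r)                                           ≡⟨ sym (rearrange e δ x c r) ⟩
    e + δ + x + c + r                                             ≡⟨ cong (λ y → y + c + r) (+-assoc e δ x) ⟩
    e + (δ + x) + c + r                                           ≡⟨ sym (swapBlocks-back e (δ + x) c r) ⟩
    swapBlocks e (δ + x) c (e + (δ + x) + c + r)                  ≡⟨ cong (λ y → swapBlocks e (δ + x) c (y + c + r)) (sym (+-assoc e δ x)) ⟩
    swapBlocks e (δ + x) c (e + δ + x + c + r)                    ∎
    where
      open ≡-Reasoning
      rearrange : ∀ e δ x c r → e + δ + x + c + r ≡ e + δ + c + (x + r)
      rearrange = solve-∀

  swapBlocks-concat-moved : ∀ e δ cs c v → swapBlocks (e + cs) δ c (swapBlocks e δ cs v) ≡ swapBlocks e δ (cs + c) v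
  swapBlocks-concat-moved e δ cs c v with blocks e δ cs v
  ... | front v<e = begin
    swapBlocks (e + cs) δ c (swapBlocks e δ cs v) ≡⟨ cong (swapBlocks (e + cs) δ c) (swapBlocks-front e δ cs v<e) ⟩
    swapBlocks (e + cs) δ c v                     ≡⟨ swapBlocks-front (e + cs) δ c (<-≤-trans v<e (m≤m+n e cs)) ⟩
    v                                             ≡⟨ sym (swapBlocks-front e δ (cs + c) v<e) ⟩
    swapBlocks e δ (cs + c) v                     ∎
    where open ≡-Reasoning
  ... | first {r} r<δ = begin
    swapBlocks (e + cs) δ c (swapBlocks e δ cs (e + r)) ≡⟨ cong (swapBlocks (e + cs) δ c) (swapBlocks-first e δ cs r<δ) ⟩
    swapBlocks (e + cs) δ c (e + cs + r)                 ≡⟨ swapBlocks-first (e + cs) δ c r<δ ⟩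
    e + cs + c + r                                       ≡⟨ cong (_+ r) (+-assoc e cs c) ⟩
    e + (cs + c) + r                                     ≡⟨ sym (swapBlocks-first e δ (cs + c) r<δ) ⟩
    swapBlocks e δ (cs + c) (e + r)                      ∎
    where open ≡-Reasoning
  ... | second {r} r<cs = begin
    swapBlocks (e + cs) δ c (swapBlocks e δ cs (e + δ + r)) ≡⟨ cong (swapBlocks (e + cs) δ c) (swapBlocks-second e δ cs r<cs) ⟩
    swapBlocks (e + cs) δ c (e + r)                          ≡⟨ swapBlocks-front (e + cs) δ c (+-monoʳ-< e r<cs) ⟩
    e + r                                                    ≡⟨ sym (swapBlocks-second e δ (cs + c) (<-≤-trans r<cs (m≤m+n cs c))) ⟩
    swapBlocks e δ (cs + c) (e + δ + r)                      ∎
    where open ≡-Reasoning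
  ... | back s with <⊎≥ c s
  ...   | inj₁ s<c = begin
    swapBlocks (e + cs) δ c (swapBlocks e δ cs (e + δ + cs + s)) ≡⟨ cong (swapBlocks (e + cs) δ c) (swapBlocks-back e δ cs s) ⟩
    swapBlocks (e + cs) δ c (e + δ + cs + s)                      ≡⟨ cong (swapBlocks (e + cs) δ c) (rearrange e δ cs s) ⟩
    swapBlocks (e + cs) δ c (e + cs + δ + s)                      ≡⟨ swapBlocks-second (e + cs) δ c s<c ⟩
    e + cs + s                                                    ≡⟨ +-assoc e cs s ⟩
    e + (cs + s)                                                  ≡⟨ sym (swapBlocks-second e δ (cs + c) (+-monoʳ-< cs s<c)) ⟩
    swapBlocks e δ (cs + c) (e + δ + (cs + s))                    ≡⟨ cong (swapBlocks e δ (cs + c)) (sym (+-assoc (e + δ) cs s)) ⟩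
    swapBlocks e δ (cs + c) (e + δ + cs + s)                      ∎
    where
      open ≡-Reasoning
      rearrange : ∀ e δ cs s → e + δ + cs + s ≡ e + cs + δ + s
      rearrange = solve-∀
  ...   | inj₂ (s′ , refl) = begin
    swapBlocks (e + cs) δ c (swapBlocks e δ cs (e + δ + cs + (c + s′))) ≡⟨ cong (swapBlocks (e + cs) δ c) (swapBlocks-back e δ cs (c + s′)) ⟩
    swapBlocks (e + cs) δ c (e + δ + cs + (c + s′))                      ≡⟨ cong (swapBlocks (e + cs) δ c) (rearrange e δ cs c s′) ⟩
    swapBlocks (e + cs) δ c (e + cs + δ + c + s′)                        ≡⟨ swapBlocks-back (e + cs) δ c s′ ⟩
    e + cs + δ + c + s′                                                  ≡⟨ rearrange′ e δ cs c s′ ⟩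
    e + δ + (cs + c) + s′                                                ≡⟨ sym (swapBlocks-back e δ (cs + c) s′) ⟩
    swapBlocks e δ (cs + c) (e + δ + (cs + c) + s′)                      ≡⟨ cong (swapBlocks e δ (cs + c)) (sym (rearrange″ e δ cs c s′)) ⟩
    swapBlocks e δ (cs + c) (e + δ + cs + (c + s′))                      ∎
    where
      open ≡-Reasoning
      rearrange : ∀ e δ cs c s′ → e + δ + cs + (c + s′) ≡ e + cs + δ + c + s′
      rearrange = solve-∀
      rearrange′ : ∀ e δ cs c s′ → e + cs + δ + c + s′ ≡ e + δ + (cs + c) + s′
      rearrange′ = solve-∀
      rearrange″ : ∀ e δ cs c s′ → e + δ + cs + (c + s′) ≡ e + δ + (cs + c) + s′
      rearrange″ = solve-∀

  lenˢ-++ : ∀ Γ Δ → lenˢ (Γ ++ Δ) ≡ lenˢ Δ + lenˢ Γ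
  lenˢ-++ Γ Δ = trans (cong length (⟦⟧ˢ-++ Γ Δ)) (length-++ ⟦ Δ ⟧ˢ)

  module Moves (Ξ : Judgement → Set) where

    substDer : ∀ {Γ Γ′} → Γ ≡ Γ′ → Der Ξ Γ → Der Ξ Γ′
    substDer refl d = d

    interp-substDer : ∀ {Γ Γ′} (e : Γ ≡ Γ′) (d : Der Ξ Γ) → interp (substDer e d) ≡ interp d
    interp-substDer refl d = refl

    move-formula : ∀ Γ C Ds E (d : Der Ξ (Γ ++ C ∷ Ds ++ E)) →
      Σ (Der Ξ (Γ ++ Ds ++ C ∷ E)) λ d′ → interp d′ ≡ relabel (swapBlocks (lenˢ E) (lenˢ Ds) (len C)) (interp d)
    move-formula Γ C [] E d = d , sym (relabel-id _ (interp d) (swapBlocks-nothing-passed (lenˢ E) (len C)))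
    move-formula Γ C (x ∷ Ds) E d = substDer (++-assoc Γ (x ∷ []) (Ds ++ C ∷ E)) (proj₁ moved) , (begin
      interp (substDer (++-assoc Γ (x ∷ []) (Ds ++ C ∷ E)) (proj₁ moved))
        ≡⟨ trans (interp-substDer (++-assoc Γ (x ∷ []) (Ds ++ C ∷ E)) (proj₁ moved)) (proj₂ moved) ⟩
      relabel (swapBlocks (lenˢ E) (lenˢ Ds) (len C)) (interp swapped)
        ≡⟨ cong (relabel _) (interp-substDer (sym (++-assoc Γ (x ∷ []) (C ∷ Ds ++ E))) (exchange Γ C x (Ds ++ E) d)) ⟩
      relabel (swapBlocks (lenˢ E) (lenˢ Ds) (len C)) (relabel (swapBlocks (lenˢ (Ds ++ E)) (len x) (len C)) (interp d))
        ≡⟨ relabel-∘ _ _ (interp d) ⟩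
      relabel (λ v → swapBlocks (lenˢ E) (lenˢ Ds) (len C) (swapBlocks (lenˢ (Ds ++ E)) (len x) (len C) v)) (interp d)
        ≡⟨ relabel-cong _ _ (interp d) composite ⟩
      relabel (swapBlocks (lenˢ E) (lenˢ (x ∷ Ds)) (len C)) (interp d) ∎)
      where
        open ≡-Reasoning
        swapped = substDer (sym (++-assoc Γ (x ∷ []) (C ∷ Ds ++ E))) (exchange Γ C x (Ds ++ E) d)
        moved = move-formula (Γ ++ x ∷ []) C Ds E swapped
        composite : ∀ v → swapBlocks (lenˢ E) (lenˢ Ds) (len C) (swapBlocks (lenˢ (Ds ++ E)) (len x) (len C) v)
                        ≡ swapBlocks (lenˢ E) (lenˢ (x ∷ Ds)) (len C) v
        composite v = begin
          swapBlocks (lenˢ E) (lenˢ Ds) (len C) (swapBlocks (lenˢ (Ds ++ E)) (len x) (len C) v)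
            ≡⟨ cong (λ n → swapBlocks (lenˢ E) (lenˢ Ds) (len C) (swapBlocks n (len x) (len C) v)) (lenˢ-++ Ds E) ⟩
          swapBlocks (lenˢ E) (lenˢ Ds) (len C) (swapBlocks (lenˢ E + lenˢ Ds) (len x) (len C) v)
            ≡⟨ swapBlocks-concat-passed (lenˢ E) (lenˢ Ds) (len x) (len C) v ⟩
          swapBlocks (lenˢ E) (lenˢ Ds + len x) (len C) v
            ≡⟨ cong (λ n → swapBlocks (lenˢ E) n (len C) v) (sym (length-++ ⟦ Ds ⟧ˢ)) ⟩
          swapBlocks (lenˢ E) (lenˢ (x ∷ Ds)) (len C) v ∎

    move-block : ∀ Γ Cs Ds E (d : Der Ξ (Γ ++ Cs ++ Ds ++ E)) →
      Σ (Der Ξ (Γ ++ Ds ++ Cs ++ E)) λ d′ → interp d′ ≡ relabel (swapBlocks (lenˢ E) (lenˢ Ds) (lenˢ Cs)) (interp d)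
    move-block Γ [] Ds E d = d , sym (relabel-id _ (interp d) (swapBlocks-nothing-moved (lenˢ E) (lenˢ Ds)))
    move-block Γ (C ∷ Cs) Ds E d = proj₁ moved , (begin
      interp (proj₁ moved)
        ≡⟨ proj₂ moved ⟩
      relabel (swapBlocks (lenˢ (Cs ++ E)) (lenˢ Ds) (len C)) (interp rest-moved)
        ≡⟨ cong (relabel _) (trans (interp-substDer (++-assoc Γ (C ∷ []) (Ds ++ Cs ++ E)) (proj₁ moved-rest)) (proj₂ moved-rest)) ⟩
      relabel (swapBlocks (lenˢ (Cs ++ E)) (lenˢ Ds) (len C)) (relabel (swapBlocks (lenˢ E) (lenˢ Ds) (lenˢ Cs)) (interp reassociated))
        ≡⟨ cong (λ r → relabel _ (relabel _ r)) (interp-substDer (sym (++-assoc Γ (C ∷ []) (Cs ++ Ds ++ E))) d) ⟩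
      relabel (swapBlocks (lenˢ (Cs ++ E)) (lenˢ Ds) (len C)) (relabel (swapBlocks (lenˢ E) (lenˢ Ds) (lenˢ Cs)) (interp d))
        ≡⟨ relabel-∘ _ _ (interp d) ⟩
      relabel (λ v → swapBlocks (lenˢ (Cs ++ E)) (lenˢ Ds) (len C) (swapBlocks (lenˢ E) (lenˢ Ds) (lenˢ Cs) v)) (interp d)
        ≡⟨ relabel-cong _ _ (interp d) composite ⟩
      relabel (swapBlocks (lenˢ E) (lenˢ Ds) (lenˢ (C ∷ Cs))) (interp d) ∎)
      where
        open ≡-Reasoning
        reassociated = substDer (sym (++-assoc Γ (C ∷ []) (Cs ++ Ds ++ E))) d
        moved-rest = move-block (Γ ++ C ∷ []) Cs Ds E reassociated
        rest-moved = substDer (++-assoc Γ (C ∷ []) (Ds ++ Cs ++ E)) (proj₁ moved-rest)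
        moved = move-formula Γ C Ds (Cs ++ E) rest-moved
        composite : ∀ v → swapBlocks (lenˢ (Cs ++ E)) (lenˢ Ds) (len C) (swapBlocks (lenˢ E) (lenˢ Ds) (lenˢ Cs) v)
                        ≡ swapBlocks (lenˢ E) (lenˢ Ds) (lenˢ (C ∷ Cs)) v
        composite v = begin
          swapBlocks (lenˢ (Cs ++ E)) (lenˢ Ds) (len C) (swapBlocks (lenˢ E) (lenˢ Ds) (lenˢ Cs) v)
            ≡⟨ cong (λ n → swapBlocks n (lenˢ Ds) (len C) (swapBlocks (lenˢ E) (lenˢ Ds) (lenˢ Cs) v)) (lenˢ-++ Cs E) ⟩
          swapBlocks (lenˢ E + lenˢ Cs) (lenˢ Ds) (len C) (swapBlocks (lenˢ E) (lenˢ Ds) (lenˢ Cs) v)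
            ≡⟨ swapBlocks-concat-moved (lenˢ E) (lenˢ Ds) (lenˢ Cs) (len C) v ⟩
          swapBlocks (lenˢ E) (lenˢ Ds) (lenˢ Cs + len C) v
            ≡⟨ cong (λ n → swapBlocks (lenˢ E) (lenˢ Ds) n v) (sym (length-++ ⟦ Cs ⟧ˢ)) ⟩
          swapBlocks (lenˢ E) (lenˢ Ds) (lenˢ (C ∷ Cs)) v ∎

  map-relabelEdge-idEdges : ∀ f n i n′ i′ X →
    (∀ j → j < length X → f (i + j) ≡ i′ + j × f ((n + n) ∸ suc (i + j)) ≡ (n′ + n′) ∸ suc (i′ + j)) →
    map (relabelEdge f) (idEdges n i X) ≡ idEdges n′ i′ X
  map-relabelEdge-idEdges f n i n′ i′ [] h = refl
  map-relabelEdge-idEdges f n i n′ i′ (b ∷ X) h = cong₂ _∷_ (head b)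
    (map-relabelEdge-idEdges f n (suc i) n′ (suc i′) X (λ j j< →
      subst₂ (λ y z → f y ≡ z × f ((n + n) ∸ suc y) ≡ (n′ + n′) ∸ suc z) (+-suc i j) (+-suc i′ j) (h (suc j) (s≤s j<))))
    where
      h₀ = h 0 (s≤s z≤n)
      left : f i ≡ i′
      left = subst₂ (λ y z → f y ≡ z) (+-identityʳ i) (+-identityʳ i′) (proj₁ h₀)
      right : f ((n + n) ∸ suc i) ≡ (n′ + n′) ∸ suc i′
      right = subst₂ (λ y z → f ((n + n) ∸ suc y) ≡ (n′ + n′) ∸ suc z) (+-identityʳ i) (+-identityʳ i′) (proj₂ h₀)
      head : ∀ b → relabelEdge f (if b then (i , [] , (n + n) ∸ suc i) else ((n + n) ∸ suc i , [] , i)) ≡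
                   (if b then (i′ , [] , (n′ + n′) ∸ suc i′) else ((n′ + n′) ∸ suc i′ , [] , i′))
      head true = cong₂ (λ y z → y , [] , z) left right
      head false = cong₂ (λ y z → y , [] , z) right left

  module EtaPar (XA XB : Boundary) where
    a = length XA
    b = length XB
    n = b + a

    -- the relabellings done by the inner exchange, the tensor and the outer exchange of eta-par
    inner outer fp fq : ℕ → ℕ
    inner = swapBlocks 0 a a
    outer = swapBlocks b (a + b) a
    fp v = if v <ᵇ a then v + b else v + b + b
    fq v = if v <ᵇ b then v else v + a

    n+n∸suc : ∀ {j} → j < n → (n + n) ∸ suc j ≡ n + (n ∸ suc j)
    n+n∸suc j<n = +-∸-assoc n j<n

    A-part : map (relabelEdge (λ x → outer (fp (inner x)))) (idEdges a 0 XA) ≡ idEdges n b XA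
    A-part = map-relabelEdge-idEdges _ a 0 n b XA (λ j j<a → start j j<a , end j j<a)
      where
        start : ∀ j → j < a → outer (fp (inner j)) ≡ b + j
        start j j<a rewrite swapBlocks-first 0 a a j<a | ≥⇒<ᵇ≡false (m≤m+n a j) =
          trans (cong outer (rearrange a j b)) (swapBlocks-second b (a + b) a j<a)
          where
            rearrange : ∀ a j b → a + j + b + b ≡ b + (a + b) + j
            rearrange = solve-∀
        end : ∀ j → j < a → outer (fp (inner ((a + a) ∸ suc j))) ≡ (n + n) ∸ suc (b + j)
        end j j<a = begin
          outer (fp (inner ((a + a) ∸ suc j)))   ≡⟨ cong (λ y → outer (fp (inner y))) (+-∸-assoc a j<a) ⟩
          outer (fp (inner (a + r)))             ≡⟨ cong (λ y → outer (fp y)) (swapBlocks-second 0 a a r<a) ⟩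
          outer (fp r)                           ≡⟨ cong outer fp-r ⟩
          outer (b + r)                          ≡⟨ swapBlocks-first b (a + b) a (<-≤-trans r<a (m≤m+n a b)) ⟩
          b + a + r                              ≡⟨ cong (n +_) (sym (trans (cong (n ∸_) (sym (+-suc b j))) ([m+n]∸[m+o]≡n∸o b a (suc j)))) ⟩
          n + (n ∸ suc (b + j))                  ≡⟨ sym (n+n∸suc (+-monoʳ-< b j<a)) ⟩
          (n + n) ∸ suc (b + j)                  ∎
          where
            open ≡-Reasoning
            r = a ∸ suc j
            r<a : r < a
            r<a = m∸suc[n]<m j<a
            fp-r : fp r ≡ b + r
            fp-r rewrite <⇒<ᵇ≡true r<a = +-comm r b

    B-part : map (relabelEdge (λ x → outer (fq x))) (idEdges b 0 XB) ≡ idEdges n 0 XB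
    B-part = map-relabelEdge-idEdges _ b 0 n 0 XB (λ j j<b → start j j<b , end j j<b)
      where
        start : ∀ j → j < b → outer (fq j) ≡ j
        start j j<b rewrite <⇒<ᵇ≡true j<b = swapBlocks-front b (a + b) a j<b
        end : ∀ j → j < b → outer (fq ((b + b) ∸ suc j)) ≡ (n + n) ∸ suc j
        end j j<b = begin
          outer (fq ((b + b) ∸ suc j))   ≡⟨ cong (λ y → outer (fq y)) (+-∸-assoc b j<b) ⟩
          outer (fq (b + s))             ≡⟨ cong outer fq-s ⟩
          outer (b + (s + a))            ≡⟨ swapBlocks-first b (a + b) a (subst (_< a + b) (+-comm a s) (+-monoʳ-< a s<b)) ⟩
          b + a + (s + a)                ≡⟨ cong (n +_) (sym (+-∸-comm a j<b)) ⟩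
          n + (n ∸ suc j)                ≡⟨ sym (n+n∸suc (<-≤-trans j<b (m≤m+n b a))) ⟩
          (n + n) ∸ suc j                ∎
          where
            open ≡-Reasoning
            s = b ∸ suc j
            s<b : s < b
            s<b = m∸suc[n]<m j<b
            fq-s : fq (b + s) ≡ b + (s + a)
            fq-s rewrite ≥⇒<ᵇ≡false (m≤m+n b s) = +-assoc b s a

    eta-edges : map (relabelEdge outer) (map (relabelEdge fp) (map (relabelEdge inner) (idEdges a 0 XA)) ++
                                         map (relabelEdge fq) (idEdges b 0 XB))
                ↭ idEdges n 0 (XB ++ XA)
    eta-edges = ↭-trans (↭-reflexive (begin
        map (relabelEdge outer) (map (relabelEdge fp) (map (relabelEdge inner) (idEdges a 0 XA)) ++ map (relabelEdge fq) (idEdges b 0 XB))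
          ≡⟨ map-++ (relabelEdge outer) (map (relabelEdge fp) (map (relabelEdge inner) (idEdges a 0 XA))) (map (relabelEdge fq) (idEdges b 0 XB)) ⟩
        map (relabelEdge outer) (map (relabelEdge fp) (map (relabelEdge inner) (idEdges a 0 XA))) ++
        map (relabelEdge outer) (map (relabelEdge fq) (idEdges b 0 XB))
          ≡⟨ cong₂ _++_ (trans (cong (map (relabelEdge outer)) (sym (map-∘ (idEdges a 0 XA)))) (sym (map-∘ (idEdges a 0 XA))))
                        (sym (map-∘ (idEdges b 0 XB))) ⟩
        map (relabelEdge (λ x → outer (fp (inner x)))) (idEdges a 0 XA) ++ map (relabelEdge (λ x → outer (fq x))) (idEdges b 0 XB)
          ≡⟨ cong₂ _++_ A-part B-part ⟩
        idEdges n b XA ++ idEdges n 0 XB ∎))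
      (↭-trans (++-comm-↭ (idEdges n b XA) (idEdges n 0 XB)) (↭-reflexive (sym (idEdges-++ n 0 XB XA))))
      where open ≡-Reasoning

  len-ᗮ : ∀ C → len (C ᗮ) ≡ len C
  len-ᗮ C = trans (cong length (⟦ᗮ⟧ C)) (length-ᵇ⊥ ⟦ C ⟧)

  eta-par : ∀ {Ξ} A B → Der Ξ (((A ⅋ B) ᗮ) ∷ A ∷ B ∷ [])
  eta-par A B = exchange [] A ((A ᗮ) ⊗ (B ᗮ)) (B ∷ [])
    (tensor (A ∷ []) (A ᗮ) (B ᗮ) (B ∷ []) (exchange [] (A ᗮ) A [] (identity A)) (identity B))

  interp-eta-par : ∀ {Ξ} A B → interp (eta-par {Ξ} A B) ↭ᵐ idRaw ⟦ A ⅋ B ⟧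
  interp-eta-par A B = generalised (len (A ᗮ)) (len (B ᗮ)) (len ((A ᗮ) ⊗ (B ᗮ))) (len-ᗮ A) (len-ᗮ B)
    (trans (length-++ ⟦ A ᗮ ⟧) (cong₂ _+_ (len-ᗮ A) (len-ᗮ B)))
    where
      -- len (A ᗮ) is only propositionally equal to len A
      generalised : ∀ a′ b′ c → a′ ≡ len A → b′ ≡ len B → c ≡ len A + len B →
        relabel (swapBlocks (len B) c (len A))
          (tensorRaw (len B) a′ b′ (relabel (swapBlocks 0 (len A) a′) (idRaw ⟦ A ⟧)) (idRaw ⟦ B ⟧))
        ↭ᵐ idRaw (⟦ B ⟧ ++ ⟦ A ⟧)
      generalised _ _ _ refl refl refl =
        ↭-trans (EtaPar.eta-edges ⟦ A ⟧ ⟦ B ⟧) (↭-reflexive (cong (λ l → idEdges l 0 (⟦ B ⟧ ++ ⟦ A ⟧)) (sym (length-++ ⟦ B ⟧))))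
        , refl

  -- Replacing an axiom by a derivation of it

  Simulates : (Judgement → Set) → (Judgement → Set) → Set
  Simulates Ξ Ξ′ = ∀ j → Ξ j → Σ (Der Ξ′ (Judgement.seq j)) λ d → interp d ↭ᵐ Judgement.cow j

  simulate : ∀ {Ξ Ξ′} → Simulates Ξ Ξ′ → ∀ {Θ} (d : Der Ξ Θ) → Σ (Der Ξ′ Θ) λ d′ → interp d′ ↭ᵐ interp d
  simulate sim (axiom j x) = sim j x
  simulate sim (identity A) = identity A , ↭ᵐ-refl
  simulate sim (exchange Γ A B Δ p) with simulate sim p
  ... | p′ , p′↭p = exchange Γ A B Δ p′ , relabel-↭ᵐ _ p′↭p
  simulate sim (par Γ A B p) with simulate sim p
  ... | p′ , p′↭p = par Γ A B p′ , p′↭p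
  simulate sim (tensor Γ A B Δ p q) with simulate sim p | simulate sim q
  ... | p′ , p′↭p | q′ , q′↭q = tensor Γ A B Δ p′ q′ , union-↭ᵐ (relabel-↭ᵐ _ p′↭p) (relabel-↭ᵐ _ q′↭q)
  simulate sim (cut Γ A Δ p q) with simulate sim p | simulate sim q
  ... | p′ , p′↭p | q′ , q′↭q = cut Γ A Δ p′ q′ , ↭ᵐ-sym
    (CutCongruence.cut-↭ᵐ ⟦ Δ ⟧ˢ ⟦ A ⟧ ⟦ Γ ⟧ˢ (interp p) (interp q) (interp p′) (interp q′)
      (premise-left-valid Γ A (interp-valid p)) (premise-right-valid A Δ (interp-valid q)) (↭ᵐ-sym p′↭p) (↭ᵐ-sym q′↭q))

  derivable-transfer : ∀ {Ξ Ξ′} → Simulates Ξ Ξ′ → ∀ Θ τ → Derivable Ξ Θ τ → Derivable Ξ′ Θ τ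
  derivable-transfer sim Θ τ (d , d≈τ) = proj₁ (simulate sim d) , ↭ᵐ⇒≈ (proj₂ (simulate sim d)) d≈τ

  module ParInversion (Ξ₀ : Judgement → Set) (Γ Δ : List Formula) (A B : Formula) (σ : Cow 𝟏 ⟦ Γ ++ (A ⅋ B) ∷ Δ ⟧ˢ) where
    open Moves

    split-boundary : ⟦ Γ ++ (A ⅋ B) ∷ Δ ⟧ˢ ≡ ⟦ Γ ++ A ∷ B ∷ Δ ⟧ˢ
    split-boundary = trans (⟦⟧ˢ-++ Γ ((A ⅋ B) ∷ Δ))
      (trans (cong (_++ ⟦ Γ ⟧ˢ) (sym (++-assoc ⟦ Δ ⟧ˢ ⟦ B ⟧ ⟦ A ⟧))) (sym (⟦⟧ˢ-++ Γ (A ∷ B ∷ Δ))))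

    split-valid : IsMultiword (⟦ Γ ++ A ∷ B ∷ Δ ⟧ˢ ⊗ᵇ (𝟏 ᵇ⊥)) (proj₁ σ)
    split-valid = subst (λ X → IsMultiword (X ⊗ᵇ (𝟏 ᵇ⊥)) (proj₁ σ)) split-boundary (proj₂ σ)

    Ξpar Ξsplit : Judgement → Set
    Ξpar = Ξ₀ ∪｛ mkJ (Γ ++ (A ⅋ B) ∷ Δ) σ ｝
    Ξsplit = Ξ₀ ∪｛ mkJ (Γ ++ A ∷ B ∷ Δ) (proj₁ σ , split-valid) ｝

    c δ : ℕ
    c = len (A ⅋ B)
    δ = lenˢ Δ

    Δ≡Δ++[] : Δ ≡ Δ ++ []
    Δ≡Δ++[] = sym (++-identityʳ Δ)

    swap-back : relabel (swapBlocks 0 c δ) (relabel (swapBlocks 0 δ c) (proj₁ σ)) ≡ proj₁ σ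
    swap-back = trans (relabel-∘ _ _ (proj₁ σ)) (relabel-id _ (proj₁ σ) (swapBlocks-involutive 0 δ c))

    par-derivable : Σ (Der Ξsplit (Γ ++ (A ⅋ B) ∷ Δ)) λ d → interp d ≡ proj₁ σ
    par-derivable = substDer Ξsplit restore moved-back , (begin
      interp (substDer Ξsplit restore moved-back)                       ≡⟨ interp-substDer Ξsplit restore moved-back ⟩
      interp moved-back                                                 ≡⟨ proj₂ pair-moved-back ⟩
      relabel (swapBlocks 0 c δ) (interp paired)                        ≡⟨ cong (relabel _) paired-interp ⟩
      relabel (swapBlocks 0 c δ) (relabel (swapBlocks 0 δ c) (proj₁ σ)) ≡⟨ swap-back ⟩
      proj₁ σ                                                           ∎)
      where
        open ≡-Reasoning
        pad = cong (λ Δ′ → Γ ++ A ∷ B ∷ Δ′) Δ≡Δ++[]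
        restore = cong (λ Δ′ → Γ ++ (A ⅋ B) ∷ Δ′) (sym Δ≡Δ++[])
        split-moved = move-block Ξsplit Γ (A ∷ B ∷ []) Δ [] (substDer Ξsplit pad (axiom _ (inj₂ refl)))
        unpaired = substDer Ξsplit (sym (++-assoc Γ Δ (A ∷ B ∷ []))) (proj₁ split-moved)
        paired = substDer Ξsplit (++-assoc Γ Δ ((A ⅋ B) ∷ [])) (par (Γ ++ Δ) A B unpaired)
        pair-moved-back = move-block Ξsplit Γ Δ ((A ⅋ B) ∷ []) [] paired
        moved-back = proj₁ pair-moved-back
        paired-interp : interp paired ≡ relabel (swapBlocks 0 δ c) (proj₁ σ)
        paired-interp = begin
          interp paired                       ≡⟨ interp-substDer Ξsplit (++-assoc Γ Δ ((A ⅋ B) ∷ [])) (par (Γ ++ Δ) A B unpaired) ⟩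
          interp unpaired                     ≡⟨ interp-substDer Ξsplit (sym (++-assoc Γ Δ (A ∷ B ∷ []))) (proj₁ split-moved) ⟩
          interp (proj₁ split-moved)          ≡⟨ proj₂ split-moved ⟩
          relabel (swapBlocks 0 δ c) (interp (substDer Ξsplit pad (axiom _ (inj₂ refl))))
                                              ≡⟨ cong (relabel _) (interp-substDer Ξsplit pad (axiom _ (inj₂ refl))) ⟩
          relabel (swapBlocks 0 δ c) (proj₁ σ) ∎

    split-derivable : Σ (Der Ξpar (Γ ++ A ∷ B ∷ Δ)) λ d → interp d ↭ᵐ proj₁ σ
    split-derivable = substDer Ξpar restore moved-back ,
      ↭ᵐ-trans (↭ᵐ-reflexive result-interp)
        (↭ᵐ-trans (relabel-↭ᵐ (swapBlocks 0 c δ) (↭ᵐ-trans eta-replaced identity-removed))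
                  (↭ᵐ-reflexive (trans (cong (relabel _) premise-interp) swap-back)))
      where
        open ≡-Reasoning
        pad = cong (λ Δ′ → Γ ++ (A ⅋ B) ∷ Δ′) Δ≡Δ++[]
        restore = cong (λ Δ′ → Γ ++ A ∷ B ∷ Δ′) (sym Δ≡Δ++[])
        axiom′ = substDer Ξpar pad (axiom _ (inj₂ refl))
        par-moved = move-block Ξpar Γ ((A ⅋ B) ∷ []) Δ [] axiom′
        premise = substDer Ξpar (sym (++-assoc Γ Δ ((A ⅋ B) ∷ []))) (proj₁ par-moved)
        cut-eta = cut (Γ ++ Δ) (A ⅋ B) (A ∷ B ∷ []) premise (eta-par A B)
        cutted = substDer Ξpar (++-assoc Γ Δ (A ∷ B ∷ [])) cut-eta
        split-moved-back = move-block Ξpar Γ Δ (A ∷ B ∷ []) [] cutted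
        moved-back = proj₁ split-moved-back
        premise-valid : IsMultiword (⟦ A ⅋ B ⟧ ++ ⟦ Γ ++ Δ ⟧ˢ) (interp premise)
        premise-valid = premise-left-valid (Γ ++ Δ) (A ⅋ B) (interp-valid premise)
        premise-interp : interp premise ≡ relabel (swapBlocks 0 δ c) (proj₁ σ)
        premise-interp = begin
          interp premise                              ≡⟨ interp-substDer Ξpar (sym (++-assoc Γ Δ ((A ⅋ B) ∷ []))) (proj₁ par-moved) ⟩
          interp (proj₁ par-moved)                    ≡⟨ proj₂ par-moved ⟩
          relabel (swapBlocks 0 δ c) (interp axiom′)  ≡⟨ cong (relabel _) (interp-substDer Ξpar pad (axiom _ (inj₂ refl))) ⟩
          relabel (swapBlocks 0 δ c) (proj₁ σ)        ∎
        result-interp : interp (substDer Ξpar restore moved-back) ≡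
                        relabel (swapBlocks 0 c δ) (cutRaw c c (interp premise) (interp (eta-par {Ξpar} A B)))
        result-interp = begin
          interp (substDer Ξpar restore moved-back)   ≡⟨ interp-substDer Ξpar restore moved-back ⟩
          interp moved-back                           ≡⟨ proj₂ split-moved-back ⟩
          relabel (swapBlocks 0 c δ) (interp cutted)  ≡⟨ cong (relabel _) (interp-substDer Ξpar (++-assoc Γ Δ (A ∷ B ∷ [])) cut-eta) ⟩
          relabel (swapBlocks 0 c δ) (cutRaw c c (interp premise) (interp (eta-par {Ξpar} A B))) ∎
        eta-replaced : cutRaw c c (interp premise) (interp (eta-par {Ξpar} A B)) ↭ᵐ cutRaw c c (interp premise) (idRaw ⟦ A ⅋ B ⟧)
        eta-replaced = CutCongruence.cut-↭ᵐ ⟦ A ⅋ B ⟧ ⟦ A ⅋ B ⟧ ⟦ Γ ++ Δ ⟧ˢ _ _ _ _ premise-valid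
          (premise-right-valid (A ⅋ B) (A ∷ B ∷ []) (interp-valid (eta-par {Ξpar} A B))) ↭ᵐ-refl (interp-eta-par {Ξpar} A B)
        identity-removed : cutRaw c c (interp premise) (idRaw ⟦ A ⅋ B ⟧) ↭ᵐ interp premise
        identity-removed = IdentityLaw.identity-law ⟦ A ⅋ B ⟧ ⟦ Γ ++ Δ ⟧ˢ (interp premise) premise-valid

    par-simulated : Simulates Ξpar Ξsplit
    par-simulated j (inj₁ j∈Ξ₀) = axiom j (inj₁ j∈Ξ₀) , ↭ᵐ-refl
    par-simulated j (inj₂ refl) = proj₁ par-derivable , ↭ᵐ-reflexive (proj₂ par-derivable)

    split-simulated : Simulates Ξsplit Ξpar
    split-simulated j (inj₁ j∈Ξ₀) = axiom j (inj₁ j∈Ξ₀) , ↭ᵐ-refl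
    split-simulated j (inj₂ refl) = split-derivable

mainTheorem9 : (t k : ℕ) (bnd : Fin k → Boundary) →
    let open Sig t k bnd in
    (Ξ₀ : Judgement → Set) (Γ Δ : List Formula) (A B : Formula)
    (σ : Cow 𝟏 ⟦ Γ ++ (A ⅋ B) ∷ Δ ⟧ˢ) →
    Σ (IsMultiword (⟦ Γ ++ A ∷ B ∷ Δ ⟧ˢ ⊗ᵇ (𝟏 ᵇ⊥)) (proj₁ σ)) λ valid′ →
    (Θ : List Formula) (τ : Cow 𝟏 ⟦ Θ ⟧ˢ) →
    Derivable (Ξ₀ ∪｛ mkJ (Γ ++ (A ⅋ B) ∷ Δ) σ ｝) Θ τ
    ⇔ Derivable (Ξ₀ ∪｛ mkJ (Γ ++ A ∷ B ∷ Δ) (proj₁ σ , valid′) ｝) Θ τ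
mainTheorem9 t k bnd Ξ₀ Γ Δ A B σ = split-valid , λ Θ τ →
  mk⇔ (derivable-transfer par-simulated Θ τ) (derivable-transfer split-simulated Θ τ)
  where
    open Cowordisms t k bnd
    open ParInversion Ξ₀ Γ Δ A B σ
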